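{- Let $G$ be a nontrivial eulerian graph with $n$ vertices and $m$ edges, and let $T$ be an euler circuit of $G$. Then $G$ has a bi-eulerian embedding in which one of the faces is bounded by $T$, and there is a nonorientable embedding of this kind unless $G$ is a cycle. These bi-eulerian embeddings have maximum Euler genus, namely $m-n$, and hence maximum orientable or nonorientable genus as appropriate, over all embeddings of $G$ having a face bounded by $T$.
   Context: Graphs are finite and may have loops and multiple edges; nontrivial means having at least one edge. A graph is eulerian if it has a circuit using every edge and vertex (an euler circuit). Embeddings are cellular in closed surfaces. A bi-eulerian embedding is an embedding with exactly two faces, each bounded by an euler circuit. The Euler genus of a surface is its genus if nonorientable and twice its genus if orientable. -}

module Defs where

open import Data.Nat using (ℕ; zero; suc; _+_; _*_; _≤_; _<_; _≤ᵇ_)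
open import Data.Nat.DivMod using (_/_)
open import Data.Integer using (ℤ; +_; _-_)
open import Data.Bool using (Bool; true; false; not; _xor_; if_then_else_; _∧_)
open import Data.Fin using (Fin; toℕ)
open import Data.Fin.Properties using () renaming (_≟_ to _≟ᶠ_)
open import Data.List using (List; []; _∷_; _++_; concatMap; map; allFin; upTo; foldr; length; filterᵇ)
open import Data.Product using (Σ; ∃; _×_; _,_; proj₁; proj₂)
open import Data.Sum using (_⊎_)
open import Relation.Nullary using (¬_; does)
open import Relation.Binary.PropositionalEquality using (_≡_)

-- Graphs with loops and multiple edges.
-- Vertices Fin n, edges Fin m; edge e has two ends, `end e false` and
-- `end e true` (equal for a loop).

record Graph (n m : ℕ) : Set where
  field
    end : Fin m → Bool → Fin n

-- A dart (half-edge / directed traversal) is an edge together with an end.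
-- Traversing dart (e , b) means going along e from end b to end (not b).
Dart : ℕ → Set
Dart m = Fin m × Bool

edge : ∀ {m} → Dart m → Fin m
edge = proj₁

flip : ∀ {m} → Dart m → Dart m
flip (e , b) = (e , not b)

vtx : ∀ {n m} → Graph n m → Dart m → Fin n
vtx G (e , b) = Graph.end G e b

hd : ∀ {n m} → Graph n m → Dart m → Fin n
hd G d = vtx G (flip d)

iter : ∀ {A : Set} → (A → A) → ℕ → A → A
iter f zero x = x
iter f (suc k) x = f (iter f k x)

allDarts : (m : ℕ) → List (Dart m)
allDarts m = concatMap (λ e → (e , false) ∷ (e , true) ∷ []) (allFin m)

count : ∀ {A : Set} → (A → Bool) → List A → ℕ
count p xs = length (filterᵇ p xs)

-- degree of a vertex: number of darts at it (a loop counts twice)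
degree : ∀ {n m} → Graph n m → Fin n → ℕ
degree G v = count (λ d → does (vtx G d ≟ᶠ v)) (allDarts _)

data Walk {n m} (G : Graph n m) : Fin n → Fin n → Set where
  nil  : ∀ {u} → Walk G u u
  cons : ∀ {w} (d : Dart m) → Walk G (hd G d) w → Walk G (vtx G d) w

Connected : ∀ {n m} → Graph n m → Set
Connected G = ∀ u v → Walk G u v

IsCycle : ∀ {n m} → Graph n m → Set
IsCycle G = Connected G × (∀ v → degree G v ≡ 2)

-- Euler circuits.  A closed walk of length m is given as an m-periodic
-- sequence of darts t 0, t 1, ... (t i followed by t (i+1)).

record EulerCircuit {n m} (G : Graph n m) : Set where
  field
    t           : ℕ → Dart m
    periodic    : ∀ i → t (i + m) ≡ t i
    consecutive : ∀ i → hd G (t i) ≡ vtx G (t (suc i))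
    allEdges    : ∀ e → ∃ λ i → i < m × edge (t i) ≡ e
    noRepeat    : ∀ i j → i < m → j < m → edge (t i) ≡ edge (t j) → i ≡ j
    allVertices : ∀ v → ∃ λ i → vtx G (t i) ≡ v

-- Embeddings, as signed rotation systems (Mohar–Thomassen, §3.3):
-- a rotation ρ (a permutation of the darts which, at every vertex, acts
-- as a single cycle on the darts at that vertex) and a signature
-- sig : edges → Bool (true = twisted / negative edge).

record Embedding {n m} (G : Graph n m) : Set where
  field
    ρ      : Dart m → Dart m
    ρ⁻     : Dart m → Dart m
    ρ⁻ρ    : ∀ d → ρ⁻ (ρ d) ≡ d
    ρρ⁻    : ∀ d → ρ (ρ⁻ d) ≡ d
    ρ-vtx  : ∀ d → vtx G (ρ d) ≡ vtx G d
    ρ-cyc  : ∀ d d' → vtx G d ≡ vtx G d' → ∃ λ k → iter ρ k d ≡ d'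
    sig    : Fin m → Bool

module _ {n m} {G : Graph n m} (E : Embedding G) where
  open Embedding E

  -- face-tracing states: a dart with the current local orientation
  -- (false = follow ρ, true = follow ρ⁻)
  State : Set
  State = Dart m × Bool

  φ : State → State
  φ (d , s) with s xor sig (edge d)
  ... | false = (ρ  (flip d) , false)
  ... | true  = (ρ⁻ (flip d) , true)

  allStates : List State
  allStates = concatMap (λ d → (d , false) ∷ (d , true) ∷ []) (allDarts m)

  bit : Bool → ℕ
  bit false = 0
  bit true = 1

  index : State → ℕ
  index ((e , b) , s) = 4 * toℕ e + 2 * bit b + bit s

  -- x is the representative (least index) of its φ-orbit
  -- (orbits have length ≤ 4m)
  isRep : State → Bool
  isRep x = foldr _∧_ true (map (λ k → index x ≤ᵇ index (iter φ k x)) (upTo (4 * m)))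

  numOrbits : ℕ
  numOrbits = count isRep allStates

  -- every face is traced by exactly two φ-orbits (its two directions)
  numFaces : ℕ
  numFaces = numOrbits / 2

  eulerGenus : ℤ
  eulerGenus = (+ (2 + m)) - (+ (n + numFaces))

  -- orientable: equivalent, by local switches, to an all-untwisted signature
  Orientable : Set
  Orientable = ∃ λ (σ : Fin n → Bool) →
    ∀ e → sig e ≡ (σ (Graph.end G e false) xor σ (Graph.end G e true))

  HasGenus : ℕ → Set
  HasGenus g = (Orientable × eulerGenus ≡ + (2 * g))
             ⊎ ((¬ Orientable) × eulerGenus ≡ + g)

  FaceAt : State → (ℕ → Dart m) → Set
  FaceAt x t = iter φ m x ≡ x × (∀ i → proj₁ (iter φ i x) ≡ t i)

  HasFaceBoundedBy : (ℕ → Dart m) → Set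
  HasFaceBoundedBy t = ∃ λ x → FaceAt x t

  BiEulerian : Set
  BiEulerian = numFaces ≡ 2
             × (∀ x → ∃ λ (T : EulerCircuit G) → FaceAt x (EulerCircuit.t T))

HasFaceT : ∀ {n m} {G : Graph n m} → Embedding G → EulerCircuit G → Set
HasFaceT E T = HasFaceBoundedBy E (EulerCircuit.t T)

-- Let MT be the transition system of the Euler circuit T: at every corner (visit of T to a
-- vertex) it pairs the dart by which T arrives with the dart by which it leaves. Walking along
-- T we build a second transition system MW whose trail W is again an Euler circuit: at a
-- vertex T has met before, the new corner is spliced into W by reversing a segment of W.
-- Rotating around each vertex alternately by MW and MT, as a 2-colouring β of the darts
-- dictates, and twisting the edges on which β is constant, yields an embedding in which every
-- face follows MT or MW; so its faces are bounded by T and by W, there are two of them, and the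
-- Euler genus is m - n. At the first revisit of a vertex two corners there receive darts of
-- different colours, whereas in an orientable embedding the colour at a corner is determined,
-- through the face bounded by T and a switching, by its vertex alone; if T revisits no vertex,
-- G is a cycle. Conversely, a face bounded by an Euler circuit uses only one of the two local
-- orientations on each edge, so the remaining states lie on at least one more face: any
-- embedding with such a face has at least two faces, hence Euler genus at most m - n.

module Submission where

open import Data.Bool using (Bool; true; false; not; _xor_; if_then_else_; T)
open import Data.Bool.Properties
  using (not-¬; not-involutive; not-injective; not-distribˡ-xor; xor-comm; xor-assoc; xor-same; xor-identityʳ)
  renaming (_≟_ to _≟ᵇ_)
open import Data.Empty using (⊥-elim)
open import Data.Fin as Fin using (Fin; toℕ; fromℕ<; combine)
open import Data.Fin.Patterns using (0F; 1F; 2F; 3F)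
open import Data.Fin.Properties
  using (toℕ-injective; toℕ<n; toℕ-fromℕ<; pigeonhole; any?; injective⇒≤; combine-injective; toℕ-combine)
  renaming (_≟_ to _≟ᶠ_)
open import Data.Integer using (+_; _-_; _⊖_; +≤+) renaming (_≤_ to _≤ℤ_)
import Data.Integer.Properties as ℤ
open import Data.List using (List; []; _∷_; _++_; [_]; _∷ʳ_; length; map; concatMap; filterᵇ; upTo)
open import Data.List.Properties using (length-++; length-map; ++-assoc; ∷-injectiveʳ; ∷ʳ-injective; ++-conicalʳ)
open import Data.List.Membership.Propositional using (_∈_)
open import Data.List.Membership.Propositional.Properties
  using (∈-++⁻; ∈-++⁺ˡ; ∈-++⁺ʳ; ∈-∃++; ∈-filter⁺; ∈-filter⁻; ∈-upTo⁺; ∈-allFin; ∈-map⁺; ∈-map⁻)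
open import Data.List.Relation.Binary.Subset.Propositional using (_⊆_)
open import Data.List.Relation.Unary.All as All using (All; []; _∷_)
open import Data.List.Relation.Unary.All.Properties using (all⁺; all⁻)
open import Data.List.Relation.Unary.AllPairs using (AllPairs; []; _∷_) renaming (map to AllPairs-map)
import Data.List.Relation.Unary.AllPairs.Properties as AllPairs
open import Data.List.Relation.Unary.Any using (here; there)
open import Data.List.Relation.Unary.Linked using (Linked; []; [-]; _∷_)
open import Data.List.Relation.Unary.Unique.Propositional using (Unique)
import Data.List.Relation.Unary.Unique.Propositional.Properties as Unique
open import Data.Nat
  using (ℕ; zero; suc; pred; _+_; _*_; _∸_; _≤_; _<_; z≤n; s≤s; _%_; _/_; _≤?_; _<?_; NonZero)
open import Data.Nat.DivMod
  using ( m≡m%n+[m/n]*n; m%n<n; m<n⇒m%n≡m; [m+kn]%n≡m%n; [m+n]%n≡m%n; n%n≡0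
        ; %-distribˡ-+; %-congˡ; /-monoˡ-≤)
open import Data.Nat.Properties
open import Data.Nat.Solver using (module +-*-Solver)
open import Data.Product using (Σ; ∃; ∃₂; _×_; _,_; proj₁; proj₂)
open import Data.Product.Properties using (≡-dec)
open import Data.Sum using (_⊎_; inj₁; inj₂)
open import Function using (_∘_; case_of_)
open import Function.Bundles using (_⇔_; module Equivalence)
open import Relation.Binary.Definitions using (DecidableEquality; tri<; tri≈; tri>)
open import Relation.Binary.PropositionalEquality hiding ([_])
open import Relation.Nullary using (¬_; Dec; does; yes; no)
open import Relation.Nullary.Decidable using (T?)
open import Defs

module _ {A : Set} (f : A → A) where

  iter-+ : ∀ a b x → iter f (a + b) x ≡ iter f a (iter f b x)
  iter-+ zero    b x = refl
  iter-+ (suc a) b x = cong f (iter-+ a b x)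

  iter-commute : ∀ k x → iter f k (f x) ≡ f (iter f k x)
  iter-commute zero    x = refl
  iter-commute (suc k) x = cong f (iter-commute k x)

  iter-*-fixed : ∀ {p x} → iter f p x ≡ x → ∀ q → iter f (q * p) x ≡ x
  iter-*-fixed         fix zero    = refl
  iter-*-fixed {p} {x} fix (suc q) =
    trans (iter-+ p (q * p) x) (trans (cong (iter f p) (iter-*-fixed fix q)) fix)

  iter-periodic : ∀ {p x} → iter f p x ≡ x → ∀ r q → iter f (r + q * p) x ≡ iter f r x
  iter-periodic {p} {x} fix r q = trans (iter-+ r (q * p) x) (cong (iter f r) (iter-*-fixed fix q))

  iter-% : ∀ {p x} .{{_ : NonZero p}} → iter f p x ≡ x → ∀ k → iter f k x ≡ iter f (k % p) x
  iter-% {p} {x} fix k =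
    trans (cong (λ j → iter f j x) (m≡m%n+[m/n]*n k p)) (iter-periodic fix (k % p) (k / p))

  iter-injective : (∀ {a b} → f a ≡ f b → a ≡ b) → ∀ k {a b} → iter f k a ≡ iter f k b → a ≡ b
  iter-injective inj zero    eq = eq
  iter-injective inj (suc k) eq = iter-injective inj k (inj eq)

  Reach : A → A → Set
  Reach x y = ∃ λ k → iter f k x ≡ y

  Reach-step : ∀ {x y} → f x ≡ y → Reach x y
  Reach-step eq = 1 , eq

  Reach-trans : ∀ {x y z} → Reach x y → Reach y z → Reach x z
  Reach-trans {x} (k , refl) (l , refl) = l + k , iter-+ l k x

module _ {A : Set} where

  unique-⊆⇒length≤ : ∀ {xs ys : List A} → Unique xs → xs ⊆ ys → length xs ≤ length ys
  unique-⊆⇒length≤ {[]}     _            _   = z≤n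
  unique-⊆⇒length≤ {x ∷ xs} (x∉xs ∷ !xs) xs⊆ys
    with ys₁ , ys₂ , refl ← ∈-∃++ (xs⊆ys (here refl)) = begin
      suc (length xs)             ≤⟨ s≤s (unique-⊆⇒length≤ !xs xs⊆ys₁ys₂) ⟩
      suc (length (ys₁ ++ ys₂))   ≡⟨ cong suc (length-++ ys₁) ⟩
      suc (length ys₁ + length ys₂) ≡⟨ +-suc (length ys₁) (length ys₂) ⟨
      length ys₁ + length (x ∷ ys₂) ≡⟨ length-++ ys₁ ⟨
      length (ys₁ ++ x ∷ ys₂)     ∎
    where
    open ≤-Reasoning
    xs⊆ys₁ys₂ : xs ⊆ ys₁ ++ ys₂
    xs⊆ys₁ys₂ {y} y∈xs with ∈-++⁻ ys₁ (xs⊆ys (there y∈xs))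
    ... | inj₁ y∈ys₁         = ∈-++⁺ˡ y∈ys₁
    ... | inj₂ (here refl)   = ⊥-elim (All.lookup x∉xs y∈xs refl)
    ... | inj₂ (there y∈ys₂) = ∈-++⁺ʳ ys₁ y∈ys₂

  withBits : List A → List (A × Bool)
  withBits = concatMap (λ a → (a , false) ∷ (a , true) ∷ [])

  ∈-withBits⁺ : ∀ {xs a} b → a ∈ xs → (a , b) ∈ withBits xs
  ∈-withBits⁺ false (here refl) = here refl
  ∈-withBits⁺ true  (here refl) = there (here refl)
  ∈-withBits⁺ b     (there a∈)  = there (there (∈-withBits⁺ b a∈))

  ∈-withBits⁻ : ∀ {xs a b} → (a , b) ∈ withBits xs → a ∈ xs
  ∈-withBits⁻ {_ ∷ _} (here refl)         = here refl
  ∈-withBits⁻ {_ ∷ _} (there (here refl)) = here refl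
  ∈-withBits⁻ {_ ∷ _} (there (there p))   = there (∈-withBits⁻ p)

  withBits⁺ : ∀ {xs} → Unique xs → Unique (withBits xs)
  withBits⁺ {[]}     []         = []
  withBits⁺ {x ∷ xs} (x∉ ∷ !xs) =
    ((λ ()) ∷ All.tabulate (fresh false)) ∷ All.tabulate (fresh true) ∷ withBits⁺ !xs
    where
    fresh : ∀ b {y} → y ∈ withBits xs → (x , b) ≢ y
    fresh b y∈ refl = All.lookup x∉ (∈-withBits⁻ y∈) refl

<-suc-cases : ∀ {j i} → j < suc i → j < i ⊎ j ≡ i
<-suc-cases j< = m≤n⇒m<n∨m≡n (≤-pred j<)

argmin : (g : ℕ → ℕ) (N : ℕ) → 0 < N → ∃ λ k → k < N × (∀ j → j < N → g k ≤ g j)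
argmin g (suc zero)    _ = 0 , s≤s z≤n , λ { zero _ → ≤-refl ; (suc j) (s≤s ()) }
argmin g (suc (suc N)) _ with k , k< , min ← argmin g (suc N) (s≤s z≤n) with g k ≤? g (suc N)
... | yes ≤last = k , m<n⇒m<1+n k< , λ j j< → case <-suc-cases j< of λ where
  (inj₁ j<N)  → min j j<N
  (inj₂ refl) → ≤last
... | no ≰last  = suc N , ≤-refl , λ j j< → case <-suc-cases j< of λ where
  (inj₁ j<N)  → ≤-trans (<⇒≤ (≰⇒> ≰last)) (min j j<N)
  (inj₂ refl) → ≤-refl

module _ {A : Set} where

  ∷⇒∃∷ʳ : ∀ (x : A) xs → ∃₂ λ ys y → x ∷ xs ≡ ys ∷ʳ y
  ∷⇒∃∷ʳ x []       = [] , x , refl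
  ∷⇒∃∷ʳ x (y ∷ xs) with ys , z , eq ← ∷⇒∃∷ʳ y xs = x ∷ ys , z , cong (x ∷_) eq

  ∷ʳ-suffix : ∀ (xs ys : List A) w ws u → xs ++ w ∷ ws ≡ ys ∷ʳ u →
              ∃ λ ws′ → w ∷ ws ≡ ws′ ∷ʳ u
  ∷ʳ-suffix []       ys       w ws u eq = ys , eq
  ∷ʳ-suffix (x ∷ xs) []       w ws u eq with () ← ++-conicalʳ xs (w ∷ ws) (∷-injectiveʳ eq)
  ∷ʳ-suffix (x ∷ xs) (y ∷ ys) w ws u eq = ∷ʳ-suffix xs ys w ws u (∷-injectiveʳ eq)

  revMap : (A → A) → List A → List A
  revMap f []       = []
  revMap f (x ∷ xs) = revMap f xs ∷ʳ f x

  length-revMap : ∀ f xs → length (revMap f xs) ≡ length xs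
  length-revMap f []       = refl
  length-revMap f (x ∷ xs) = trans (length-++ (revMap f xs)) (trans (+-comm _ 1) (cong suc (length-revMap f xs)))

  revMap-∷ʳ : ∀ f xs y → revMap f (xs ∷ʳ y) ≡ f y ∷ revMap f xs
  revMap-∷ʳ f []       y = refl
  revMap-∷ʳ f (x ∷ xs) y = cong (_∷ʳ f x) (revMap-∷ʳ f xs y)

  ∈-revMap⁻ : ∀ f xs {y} → y ∈ revMap f xs → ∃ λ x → x ∈ xs × y ≡ f x
  ∈-revMap⁻ f (x ∷ xs) y∈ with ∈-++⁻ (revMap f xs) y∈
  ... | inj₁ y∈xs with x′ , x′∈ , eq ← ∈-revMap⁻ f xs y∈xs = x′ , there x′∈ , eq
  ∈-revMap⁻ f (x ∷ xs) y∈ | inj₂ (here refl) = x , here refl , refl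

  ∈-revMap⁺ : ∀ f {xs x} → x ∈ xs → f x ∈ revMap f xs
  ∈-revMap⁺ f {x ∷ xs} (here refl) = ∈-++⁺ʳ (revMap f xs) (here refl)
  ∈-revMap⁺ f {x ∷ xs} (there x∈)  = ∈-++⁺ˡ (∈-revMap⁺ f x∈)

  module _ {R : A → A → Set} where

    AllPairs-++⁻ : ∀ xs {ys} → AllPairs R (xs ++ ys) →
                   AllPairs R xs × AllPairs R ys × (∀ {x y} → x ∈ xs → y ∈ ys → R x y)
    AllPairs-++⁻ []       rs        = [] , rs , λ ()
    AllPairs-++⁻ (x ∷ xs) (rx ∷ rs) with rxs , rys , across ← AllPairs-++⁻ xs rs =
      All.tabulate (All.lookup rx ∘ ∈-++⁺ˡ) ∷ rxs , rys , λ where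
        (here refl) y∈ → All.lookup rx (∈-++⁺ʳ xs y∈)
        (there x∈)  y∈ → across x∈ y∈

    AllPairs-++⁺ : ∀ {xs ys} → AllPairs R xs → AllPairs R ys →
                   (∀ {x y} → x ∈ xs → y ∈ ys → R x y) → AllPairs R (xs ++ ys)
    AllPairs-++⁺ rxs rys across =
      AllPairs.++⁺ rxs rys (All.tabulate λ x∈ → All.tabulate (across x∈))

    AllPairs-revMap : ∀ f → (∀ {x y} → R x y → R (f y) (f x)) →
                      ∀ {xs} → AllPairs R xs → AllPairs R (revMap f xs)
    AllPairs-revMap f swap {[]}     []        = []
    AllPairs-revMap f swap {x ∷ xs} (rx ∷ rs) = AllPairs-++⁺ (AllPairs-revMap f swap rs) ([] ∷ []) λ where
      y∈ (here refl) → let x′ , x′∈ , eq = ∈-revMap⁻ f xs y∈ in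
        subst (λ y → R y (f x)) (sym eq) (swap (All.lookup rx x′∈))

    Linked-split : ∀ xs y ys → Linked R (xs ++ y ∷ ys) → Linked R (xs ∷ʳ y) × Linked R (y ∷ ys)
    Linked-split []           y ys l        = [-] , l
    Linked-split (x ∷ [])     y ys (r ∷ l)  = r ∷ [-] , l
    Linked-split (x ∷ x′ ∷ xs) y ys (r ∷ l)
      with l₁ , l₂ ← Linked-split (x′ ∷ xs) y ys l = r ∷ l₁ , l₂

    Linked-join : ∀ xs y ys → Linked R (xs ∷ʳ y) → Linked R (y ∷ ys) → Linked R (xs ++ y ∷ ys)
    Linked-join []            y ys _        l₂ = l₂
    Linked-join (x ∷ [])      y ys (r ∷ _)  l₂ = r ∷ l₂
    Linked-join (x ∷ x′ ∷ xs) y ys (r ∷ l₁) l₂ = r ∷ Linked-join (x′ ∷ xs) y ys l₁ l₂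

    Linked-∷ʳ : ∀ xs y z → Linked R (xs ∷ʳ y) → R y z → Linked R (xs ∷ʳ y ∷ʳ z)
    Linked-∷ʳ xs y z l r = subst (Linked R) (sym (++-assoc xs [ y ] [ z ])) (Linked-join xs y [ z ] l (r ∷ [-]))

    Linked-revMap : ∀ f → (∀ {x y} → R x y → R (f y) (f x)) →
                    ∀ {xs} → Linked R xs → Linked R (revMap f xs)
    Linked-revMap f rev {[]}         []      = []
    Linked-revMap f rev {x ∷ []}     [-]     = [-]
    Linked-revMap f rev {x ∷ y ∷ xs} (r ∷ l) =
      Linked-∷ʳ (revMap f xs) (f y) (f x) (Linked-revMap f rev l) (rev r)

  Linked-transfer : ∀ {R R′ : A → A → Set} (P Q : A → Set) →
                    (∀ {x y} → P x → P y → Q y → R x y → R′ x y) →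
                    ∀ {x xs} → Linked R (x ∷ xs) → P x → All (λ y → P y × Q y) xs → Linked R′ (x ∷ xs)
  Linked-transfer P Q transfer [-]     _  []                = [-]
  Linked-transfer P Q transfer (r ∷ l) px ((py , qy) ∷ pqs) =
    transfer px py qy r ∷ Linked-transfer P Q transfer l py pqs

module _ {A : Set} (_≟_ : DecidableEquality A) (u v : A) where

  transpose : A → A
  transpose x with x ≟ u | x ≟ v
  ... | yes _ | _     = v
  ... | no _  | yes _ = u
  ... | no _  | no _  = x

  transpose-u : transpose u ≡ v
  transpose-u with u ≟ u
  ... | yes _ = refl
  ... | no u≢u = ⊥-elim (u≢u refl)

  transpose-v : transpose v ≡ u
  transpose-v with v ≟ u | v ≟ v
  ... | yes v≡u | _     = v≡u
  ... | no _    | yes _ = refl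
  ... | no _    | no v≢v = ⊥-elim (v≢v refl)

  transpose-other : ∀ {x} → x ≢ u → x ≢ v → transpose x ≡ x
  transpose-other {x} x≢u x≢v with x ≟ u | x ≟ v
  ... | yes x≡u | _     = ⊥-elim (x≢u x≡u)
  ... | no _    | yes x≡v = ⊥-elim (x≢v x≡v)
  ... | no _    | no _  = refl

  transpose-involutive : ∀ x → transpose (transpose x) ≡ x
  transpose-involutive x with x ≟ u | x ≟ v
  ... | yes refl | _        = transpose-v
  ... | no _     | yes refl = transpose-u
  ... | no x≢u   | no x≢v   = transpose-other x≢u x≢v

  transpose-resp : ∀ {B : Set} (f : A → B) → f u ≡ f v → ∀ x → f (transpose x) ≡ f x
  transpose-resp f fu≡fv x with x ≟ u | x ≟ v
  ... | yes refl | _        = sym fu≡fv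
  ... | no _     | yes refl = fu≡fv
  ... | no _     | no _     = refl

module _ {A : Set} (d : A) where

  nth : List A → ℕ → A
  nth []       i       = d
  nth (x ∷ xs) zero    = x
  nth (x ∷ xs) (suc i) = nth xs i

  nth-∈ : ∀ xs {i} → i < length xs → nth xs i ∈ xs
  nth-∈ (x ∷ xs) {zero}  _  = here refl
  nth-∈ (x ∷ xs) {suc i} i< = there (nth-∈ xs (≤-pred i<))

  nth-∷ʳ : ∀ xs y → nth (xs ∷ʳ y) (length xs) ≡ y
  nth-∷ʳ []       y = refl
  nth-∷ʳ (x ∷ xs) y = nth-∷ʳ xs y

  nth-Linked : ∀ {R : A → A → Set} {xs} → Linked R xs →
               ∀ {i} → suc i < length xs → R (nth xs i) (nth xs (suc i))
  nth-Linked [-]     {_}     (s≤s ())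
  nth-Linked (r ∷ l) {zero}  _  = r
  nth-Linked (r ∷ l) {suc i} i< = nth-Linked l (≤-pred i<)

  nth-injective : ∀ {B : Set} (f : A → B) {xs} → AllPairs (λ x y → f x ≢ f y) xs →
                  ∀ {i j} → i < length xs → j < length xs → f (nth xs i) ≡ f (nth xs j) → i ≡ j
  nth-injective f {x ∷ xs} (fx≢ ∷ _) {zero}  {zero}  _  _  _  = refl
  nth-injective f {x ∷ xs} (fx≢ ∷ _) {zero}  {suc j} _  j< eq =
    ⊥-elim (All.lookup fx≢ (nth-∈ xs (≤-pred j<)) eq)
  nth-injective f {x ∷ xs} (fx≢ ∷ _) {suc i} {zero}  i< _  eq =
    ⊥-elim (All.lookup fx≢ (nth-∈ xs (≤-pred i<)) (sym eq))
  nth-injective f {x ∷ xs} (_ ∷ fs)  {suc i} {suc j} i< j< eq =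
    cong suc (nth-injective f fs (≤-pred i<) (≤-pred j<) eq)

module _ {P : Set} where

  T-does⇒ : (d : Dec P) → T (does d) → P
  T-does⇒ (yes p) _ = p

  ⇒T-does : (d : Dec P) → P → T (does d)
  ⇒T-does (yes _) _ = _
  ⇒T-does (no ¬p) p = ¬p p

%-cong-+ʳ : ∀ {m} .{{_ : NonZero m}} a b c → a % m ≡ b % m → (a + c) % m ≡ (b + c) % m
%-cong-+ʳ {m} a b c eq = begin
  (a + c) % m               ≡⟨ %-distribˡ-+ a c m ⟩
  (a % m + c % m) % m       ≡⟨ cong (λ r → (r + c % m) % m) eq ⟩
  (b % m + c % m) % m       ≡⟨ %-distribˡ-+ b c m ⟨
  (b + c) % m               ∎
  where open ≡-Reasoning

module _ (m′ : ℕ) where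
  private
    m = suc m′
    open +-*-Solver

  +-cancelˡ-% : ∀ a x y → (a + x) % m ≡ (a + y) % m → x % m ≡ y % m
  +-cancelˡ-% a x y eq = begin
    x % m                    ≡⟨ [m+kn]%n≡m%n x a m ⟨
    (x + a * m) % m          ≡⟨ %-congˡ (complete x) ⟩
    ((a + x) + a * m′) % m   ≡⟨ %-cong-+ʳ (a + x) (a + y) (a * m′) eq ⟩
    ((a + y) + a * m′) % m   ≡⟨ %-congˡ (complete y) ⟨
    (y + a * m) % m          ≡⟨ [m+kn]%n≡m%n y a m ⟩
    y % m                    ∎
    where
    open ≡-Reasoning
    complete : ∀ z → z + a * m ≡ (a + z) + a * m′
    complete z = solve 3 (λ a z m′ → z :+ a :* (con 1 :+ m′) := (a :+ z) :+ a :* m′) refl a z m′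

  -- Modulo m, multiplying by m′ is multiplying by -1.
  *-m′-injective-% : ∀ {i j} → i < m → j < m → (i * m′) % m ≡ (j * m′) % m → i ≡ j
  *-m′-injective-% {i} {j} i< j< eq = begin
    i                        ≡⟨ m<n⇒m%n≡m i< ⟨
    i % m                    ≡⟨ negate j i ⟨
    (j * m′ + (j + i)) % m   ≡⟨ %-cong-+ʳ (i * m′) (j * m′) (j + i) eq ⟨
    (i * m′ + (j + i)) % m   ≡⟨ cong (λ z → (i * m′ + z) % m) (+-comm j i) ⟩
    (i * m′ + (i + j)) % m   ≡⟨ negate i j ⟩
    j % m                    ≡⟨ m<n⇒m%n≡m j< ⟩
    j                        ∎
    where
    open ≡-Reasoning
    negate : ∀ x y → (x * m′ + (x + y)) % m ≡ y % m
    negate x y = trans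
      (%-congˡ (solve 3 (λ x y m′ → x :* m′ :+ (x :+ y) := y :+ x :* (con 1 :+ m′)) refl x y m′))
      ([m+kn]%n≡m%n y x m)

injective⇒surjective : ∀ {m} (f : ℕ → Fin m) → (∀ {i j} → i < m → j < m → f i ≡ f j → i ≡ j) →
                       ∀ e → ∃ λ i → i < m × f i ≡ e
injective⇒surjective {m} f inj e with any? (λ (i : Fin m) → f (toℕ i) ≟ᶠ e)
... | yes (i , eq) = toℕ i , toℕ<n i , eq
... | no ∉image    = ⊥-elim (<-irrefl refl (injective⇒≤ g-injective))
  where
  g : Fin (suc m) → Fin m
  g Fin.zero    = e
  g (Fin.suc i) = f (toℕ i)
  g-injective : ∀ {x y} → g x ≡ g y → x ≡ y
  g-injective {Fin.zero}  {Fin.zero}  _  = refl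
  g-injective {Fin.zero}  {Fin.suc j} eq = ⊥-elim (∉image (j , sym eq))
  g-injective {Fin.suc i} {Fin.zero}  eq = ⊥-elim (∉image (i , eq))
  g-injective {Fin.suc i} {Fin.suc j} eq = cong Fin.suc (toℕ-injective (inj (toℕ<n i) (toℕ<n j) eq))

-- Darts and face tracing

flip-involutive : ∀ {m} (d : Dart m) → flip (flip d) ≡ d
flip-involutive (e , false) = refl
flip-involutive (e , true)  = refl

flip-≢ : ∀ {m} (d : Dart m) → flip d ≢ d
flip-≢ (e , true)  ()
flip-≢ (e , false) ()

same-edge⇒≡⊎flip : ∀ {m} (x y : Dart m) → edge x ≡ edge y → x ≡ y ⊎ x ≡ flip y
same-edge⇒≡⊎flip (e , false) (.e , false) refl = inj₁ refl
same-edge⇒≡⊎flip (e , false) (.e , true)  refl = inj₂ refl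
same-edge⇒≡⊎flip (e , true)  (.e , false) refl = inj₂ refl
same-edge⇒≡⊎flip (e , true)  (.e , true)  refl = inj₁ refl

_≟ᵈ_ : ∀ {m} → DecidableEquality (Dart m)
_≟ᵈ_ = ≡-dec _≟ᶠ_ _≟ᵇ_

allDarts-complete : ∀ {m} (d : Dart m) → d ∈ allDarts m
allDarts-complete (e , b) = ∈-withBits⁺ b (∈-allFin e)

allDarts-unique : ∀ m → Unique (allDarts m)
allDarts-unique m = withBits⁺ (Unique.allFin⁺ m)

module FaceTracing {n m} {G : Graph n m} (E : Embedding G) where
  open Embedding E

  rot : Bool → Dart m → Dart m
  rot false = ρ
  rot true  = ρ⁻

  rot-inverse : ∀ b d → rot (not b) (rot b d) ≡ d
  rot-inverse false = ρ⁻ρ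
  rot-inverse true  = ρρ⁻

  φ-≡ : ∀ d s → φ E (d , s) ≡ (rot (s xor sig (edge d)) (flip d) , s xor sig (edge d))
  φ-≡ d s with s xor sig (edge d)
  ... | false = refl
  ... | true  = refl

  -- rev x traverses the face of x in the opposite direction.
  rev : State E → State E
  rev (d , s) = (flip d , not (s xor sig (edge d)))

  rev-involutive : ∀ x → rev (rev x) ≡ x
  rev-involutive ((e , b) , s) = cong₂ _,_ (flip-involutive (e , b)) (not-xor-not s (sig e))
    where
    not-xor-not : ∀ s c → not (not (s xor c) xor c) ≡ s
    not-xor-not false false = refl
    not-xor-not false true  = refl
    not-xor-not true  false = refl
    not-xor-not true  true  = refl

  φ∘rev∘φ : ∀ y → φ E (rev (φ E y)) ≡ rev y
  φ∘rev∘φ (d , s) = begin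
      φ E (rev (φ E (d , s)))            ≡⟨ cong (φ E ∘ rev) (φ-≡ d s) ⟩
      φ E (rev (d′ , b))                 ≡⟨ φ-≡ (flip d′) (not (b xor c)) ⟩
      (rot b′ (flip (flip d′)) , b′)
        ≡⟨ cong₂ _,_ (cong₂ rot (not-xor b c) (flip-involutive d′)) (not-xor b c) ⟩
      (rot (not b) (rot b (flip d)) , not b) ≡⟨ cong (_, not b) (rot-inverse b (flip d)) ⟩
      (flip d , not b)                   ∎
    where
    open ≡-Reasoning
    b  = s xor sig (edge d)
    d′ = rot b (flip d)
    c  = sig (edge d′)
    b′ = not (b xor c) xor c
    not-xor : ∀ a c → not (a xor c) xor c ≡ not a
    not-xor false false = refl
    not-xor false true  = refl
    not-xor true  false = refl
    not-xor true  true  = refl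

  φ-injective : ∀ {x y} → φ E x ≡ φ E y → x ≡ y
  φ-injective {x} {y} eq = begin
    x                     ≡⟨ rev-involutive x ⟨
    rev (rev x)           ≡⟨ cong rev (φ∘rev∘φ x) ⟨
    rev (φ E (rev (φ E x))) ≡⟨ cong (λ z → rev (φ E (rev z))) eq ⟩
    rev (φ E (rev (φ E y))) ≡⟨ cong rev (φ∘rev∘φ y) ⟩
    rev (rev y)           ≡⟨ rev-involutive y ⟩
    y                     ∎
    where open ≡-Reasoning

  Orbit : State E → State E → Set
  Orbit = Reach (φ E)

  iter-rev : ∀ k y → iter (φ E) k (rev (iter (φ E) k y)) ≡ rev y
  iter-rev zero    y = refl
  iter-rev (suc k) y = begin
    φ E (iter (φ E) k (rev (φ E (iter (φ E) k y)))) ≡⟨ iter-commute (φ E) k _ ⟨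
    iter (φ E) k (φ E (rev (φ E (iter (φ E) k y))))  ≡⟨ cong (iter (φ E) k) (φ∘rev∘φ (iter (φ E) k y)) ⟩
    iter (φ E) k (rev (iter (φ E) k y))              ≡⟨ iter-rev k y ⟩
    rev y                                            ∎
    where open ≡-Reasoning

  Orbit-rev : ∀ {x y} → Orbit x y → Orbit (rev y) (rev x)
  Orbit-rev {x} (k , refl) = k , iter-rev k x

  orbit-avoids-rev : ∀ k z → iter (φ E) k z ≢ rev z
  orbit-avoids-rev zero          (d , s) eq = flip-≢ d (sym (cong proj₁ eq))
  orbit-avoids-rev (suc zero)    (d , s) eq = not-¬ refl (trans (sym (cong proj₂ (φ-≡ d s))) (cong proj₂ eq))
  orbit-avoids-rev (suc (suc k)) z       eq = orbit-avoids-rev k (φ E z) (φ-injective (begin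
    φ E (iter (φ E) k (φ E z))   ≡⟨ cong (φ E) (iter-commute (φ E) k z) ⟩
    iter (φ E) (suc (suc k)) z   ≡⟨ eq ⟩
    rev z                        ≡⟨ φ∘rev∘φ z ⟨
    φ E (rev (φ E z))            ∎))
    where open ≡-Reasoning

  private
    bits : Bool → Bool → Fin 4
    bits false false = 0F
    bits false true  = 1F
    bits true  false = 2F
    bits true  true  = 3F

    unbits : Fin 4 → Bool × Bool
    unbits 0F = false , false
    unbits 1F = false , true
    unbits 2F = true  , false
    unbits 3F = true  , true

    unbits-bits : ∀ b s → unbits (bits b s) ≡ (b , s)
    unbits-bits false false = refl
    unbits-bits false true  = refl
    unbits-bits true  false = refl
    unbits-bits true  true  = refl

    toℕ-bits : ∀ b s → toℕ (bits b s) ≡ 2 * bit E b + bit E s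
    toℕ-bits false false = refl
    toℕ-bits false true  = refl
    toℕ-bits true  false = refl
    toℕ-bits true  true  = refl

  encode : State E → Fin (m * 4)
  encode ((e , b) , s) = combine e (bits b s)

  encode-injective : ∀ {x y} → encode x ≡ encode y → x ≡ y
  encode-injective {(e , b) , s} {(e′ , b′) , s′} eq
    with refl , eq′ ← combine-injective e (bits b s) e′ (bits b′ s′) eq
    with refl ← trans (sym (unbits-bits b s)) (trans (cong unbits eq′) (unbits-bits b′ s′)) = refl

  index≡toℕ∘encode : ∀ x → index E x ≡ toℕ (encode x)
  index≡toℕ∘encode ((e , b) , s) = begin
    4 * toℕ e + 2 * bit E b + bit E s   ≡⟨ +-assoc (4 * toℕ e) _ _ ⟩
    4 * toℕ e + (2 * bit E b + bit E s) ≡⟨ cong (λ r → 4 * toℕ e + r) (toℕ-bits b s) ⟨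
    4 * toℕ e + toℕ (bits b s)          ≡⟨ toℕ-combine e (bits b s) ⟨
    toℕ (combine e (bits b s))          ∎
    where open ≡-Reasoning

  index-injective : ∀ {x y} → index E x ≡ index E y → x ≡ y
  index-injective {x} {y} eq =
    encode-injective (toℕ-injective (trans (sym (index≡toℕ∘encode x)) (trans eq (index≡toℕ∘encode y))))

  period : ∀ y → ∃ λ p → 0 < p × p ≤ 4 * m × iter (φ E) p y ≡ y
  period y with i , j , i<j , eq ← pigeonhole (n<1+n (m * 4)) (λ k → encode (iter (φ E) (toℕ k) y)) =
    toℕ j ∸ toℕ i , m<n⇒0<n∸m i<j , bound , fixed
    where
    bound : toℕ j ∸ toℕ i ≤ 4 * m
    bound = ≤-trans (m∸n≤m (toℕ j) (toℕ i)) (subst (toℕ j ≤_) (*-comm m 4) (≤-pred (toℕ<n j)))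
    fixed : iter (φ E) (toℕ j ∸ toℕ i) y ≡ y
    fixed = iter-injective (φ E) φ-injective (toℕ i) (begin
      iter (φ E) (toℕ i) (iter (φ E) (toℕ j ∸ toℕ i) y) ≡⟨ iter-+ (φ E) (toℕ i) _ y ⟨
      iter (φ E) (toℕ i + (toℕ j ∸ toℕ i)) y
        ≡⟨ cong (λ k → iter (φ E) k y) (m+[n∸m]≡n (<⇒≤ i<j)) ⟩
      iter (φ E) (toℕ j) y                             ≡⟨ encode-injective eq ⟨
      iter (φ E) (toℕ i) y                             ∎)
      where open ≡-Reasoning

  orbit-within-period : ∀ {x y p} → 0 < p → iter (φ E) p x ≡ x → Orbit x y →
                        ∃ λ r → r < p × iter (φ E) r x ≡ y
  orbit-within-period {p = suc _} _ fixed (k , refl) = k % _ , m%n<n k _ , sym (iter-% (φ E) fixed k)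

  Orbit-bounded : ∀ {x y} → Orbit x y → ∃ λ k → k < 4 * m × iter (φ E) k x ≡ y
  Orbit-bounded {x} o with p , 0<p , p≤ , fixed ← period x
                      with r , r<p , eq ← orbit-within-period 0<p fixed o = r , <-≤-trans r<p p≤ , eq

  Orbit-sym : ∀ {x y} → Orbit x y → Orbit y x
  Orbit-sym {x} o with p , 0<p , _ , fixed ← period x
                  with r , r<p , refl ← orbit-within-period 0<p fixed o =
    p ∸ r , trans (sym (iter-+ (φ E) (p ∸ r) r x))
                  (trans (cong (λ j → iter (φ E) j x) (m∸n+n≡m (<⇒≤ r<p))) fixed)

  isRep⇒minimal : ∀ {r} → T (isRep E r) → ∀ k → k < 4 * m → index E r ≤ index E (iter (φ E) k r)
  isRep⇒minimal isR k k< = ≤ᵇ⇒≤ _ _ (All.lookup (all⁺ _ (upTo (4 * m)) isR) (∈-upTo⁺ k<))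

  representative : ∀ y → ∃ λ r → Orbit y r × T (isRep E r)
  representative y with p , 0<p , _ , fixed ← period y
                   with k , _ , min ← argmin (λ k → index E (iter (φ E) k y)) p 0<p =
    iter (φ E) k y , (k , refl) , all⁻ _ {upTo (4 * m)} (All.tabulate λ {j} _ → ≤⇒≤ᵇ (minimal j))
    where
    minimal : ∀ j → index E (iter (φ E) k y) ≤ index E (iter (φ E) j (iter (φ E) k y))
    minimal j with r , r<p , eq ← orbit-within-period 0<p fixed (j + k , refl) =
      subst (λ z → index E (iter (φ E) k y) ≤ index E z) (trans eq (iter-+ (φ E) j k y)) (min r r<p)

  rep : State E → State E
  rep y = proj₁ (representative y)

  rep-unique : ∀ {r r′} → T (isRep E r) → T (isRep E r′) → Orbit r r′ → r ≡ r′
  rep-unique {r} {r′} isR isR′ o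
    with k , k< , refl ← Orbit-bounded o
    with k′ , k′< , eq′ ← Orbit-bounded (Orbit-sym o) =
    index-injective (≤-antisym (isRep⇒minimal isR k k<)
                               (subst (λ z → index E r′ ≤ index E z) eq′ (isRep⇒minimal isR′ k′ k′<)))

  allStates-complete : ∀ x → x ∈ allStates E
  allStates-complete (d , s) = ∈-withBits⁺ s (allDarts-complete d)

  numOrbits-≥ : ∀ zs → AllPairs (λ x y → ¬ Orbit x y) zs → length zs ≤ numOrbits E
  numOrbits-≥ zs apart = subst (_≤ numOrbits E) (length-map rep zs)
    (unique-⊆⇒length≤ (AllPairs.map⁺ (AllPairs-map distinct-reps apart)) reps⊆)
    where
    distinct-reps : ∀ {x y} → ¬ Orbit x y → rep x ≢ rep y
    distinct-reps {x} {y} ¬o eq =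
      ¬o (Reach-trans (φ E) (proj₁ (proj₂ (representative x)))
                            (subst (λ r → Orbit r y) (sym eq) (Orbit-sym (proj₁ (proj₂ (representative y))))))
    reps⊆ : ∀ {r} → r ∈ map rep zs → r ∈ filterᵇ (isRep E) (allStates E)
    reps⊆ r∈ with z , _ , refl ← ∈-map⁻ rep r∈ =
      ∈-filter⁺ (T? ∘ isRep E) (allStates-complete _) (proj₂ (proj₂ (representative z)))

  numOrbits-≤ : ∀ zs → (∀ x → ∃ λ z → z ∈ zs × Orbit z x) → numOrbits E ≤ length zs
  numOrbits-≤ zs cover = subst (numOrbits E ≤_) (length-map rep zs)
    (unique-⊆⇒length≤ (Unique.filter⁺ (T? ∘ isRep E) (withBits⁺ (allDarts-unique m))) ⊆reps)
    where
    ⊆reps : ∀ {x} → x ∈ filterᵇ (isRep E) (allStates E) → x ∈ map rep zs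
    ⊆reps {x} x∈ with _ , isR ← ∈-filter⁻ (T? ∘ isRep E) {xs = allStates E} x∈ | z , z∈ , o ← cover x =
      subst (_∈ map rep zs) (sym (rep-unique isR (proj₂ (proj₂ (representative z)))
                                   (Reach-trans (φ E) (Orbit-sym o) (proj₁ (proj₂ (representative z))))))
            (∈-map⁺ rep z∈)

module _ {n m′} {G : Graph n (suc m′)} (E : Embedding G) where
  open FaceTracing E
  private
    m = suc m′
    open +-*-Solver

  FaceAt-shift : ∀ {z u} → FaceAt E z u → ∀ k → FaceAt E (iter (φ E) k z) (λ i → u (i + k))
  FaceAt-shift {z} {u} (fixed , boundary) k =
    closes , λ i → trans (cong proj₁ (sym (iter-+ (φ E) i k z))) (boundary (i + k))
    where
    open ≡-Reasoning
    closes : iter (φ E) m (iter (φ E) k z) ≡ iter (φ E) k z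
    closes = begin
      iter (φ E) m (iter (φ E) k z) ≡⟨ iter-+ (φ E) m k z ⟨
      iter (φ E) (m + k) z          ≡⟨ cong (λ j → iter (φ E) j z) (+-comm m k) ⟩
      iter (φ E) (k + m) z          ≡⟨ iter-+ (φ E) k m z ⟩
      iter (φ E) k (iter (φ E) m z) ≡⟨ cong (iter (φ E) k) fixed ⟩
      iter (φ E) k z                ∎

  -- Going forward from rev z goes backwards along the face of z, and on a face of length m
  -- one step back is m′ steps forward.
  iter-from-rev : ∀ {z} → iter (φ E) m z ≡ z →
                  ∀ c i → iter (φ E) i (rev (iter (φ E) c z)) ≡ rev (iter (φ E) (c + i * m′) z)
  iter-from-rev {z} fixed c zero    = cong (λ j → rev (iter (φ E) j z)) (sym (+-identityʳ c))
  iter-from-rev {z} fixed c (suc i) = begin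
    φ E (iter (φ E) i (rev (iter (φ E) c z)))     ≡⟨ cong (φ E) (iter-from-rev fixed c i) ⟩
    φ E (rev (iter (φ E) (c + i * m′) z))         ≡⟨ cong (φ E ∘ rev) back ⟨
    φ E (rev (φ E (iter (φ E) (c + suc i * m′) z))) ≡⟨ φ∘rev∘φ (iter (φ E) (c + suc i * m′) z) ⟩
    rev (iter (φ E) (c + suc i * m′) z)           ∎
    where
    open ≡-Reasoning
    back : φ E (iter (φ E) (c + suc i * m′) z) ≡ iter (φ E) (c + i * m′) z
    back = trans (cong (λ j → iter (φ E) j z) (solve 3
                   (λ c i m′ → con 1 :+ (c :+ (m′ :+ i :* m′)) := (c :+ i :* m′) :+ con 1 :* (con 1 :+ m′))
                   refl c i m′))
                 (iter-periodic (φ E) fixed (c + i * m′) 1)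

  FaceAt-rev : ∀ {z u} → FaceAt E z u →
               ∀ c → FaceAt E (rev (iter (φ E) c z)) (λ i → flip (u (c + i * m′)))
  FaceAt-rev {z} {u} (fixed , boundary) c =
    trans (iter-from-rev fixed c m)
          (cong rev (trans (cong (λ j → iter (φ E) (c + j) z) (*-comm m m′)) (iter-periodic (φ E) fixed c m′))) ,
    λ i → trans (cong proj₁ (iter-from-rev fixed c i)) (cong flip (boundary (c + i * m′)))

-- Euler circuits

module Circuit {n m′} {G : Graph n (suc m′)} (C : EulerCircuit G) where
  open EulerCircuit C
  private
    m = suc m′
    open +-*-Solver

  t-periodic : ∀ r q → t (r + q * m) ≡ t r
  t-periodic r zero    = cong t (+-identityʳ r)
  t-periodic r (suc q) = begin
    t (r + (m + q * m)) ≡⟨ cong t (solve 3 (λ r q m → r :+ (m :+ q :* m) := (r :+ q :* m) :+ m) refl r q m) ⟩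
    t ((r + q * m) + m) ≡⟨ periodic (r + q * m) ⟩
    t (r + q * m)       ≡⟨ t-periodic r q ⟩
    t r                 ∎
    where open ≡-Reasoning

  t-% : ∀ k → t k ≡ t (k % m)
  t-% k = trans (cong t (m≡m%n+[m/n]*n k m)) (t-periodic (k % m) (k / m))

  edge-t-injective-% : ∀ a b → edge (t a) ≡ edge (t b) → a % m ≡ b % m
  edge-t-injective-% a b eq = noRepeat (a % m) (b % m) (m%n<n a m) (m%n<n b m)
    (trans (cong edge (sym (t-% a))) (trans eq (cong edge (t-% b))))

  closedWalk⇒EulerCircuit : (u : ℕ → Dart m) → (∀ i → u (i + m) ≡ u i) →
                            (∀ i → hd G (u i) ≡ vtx G (u (suc i))) →
                            (∀ i j → i < m → j < m → edge (u i) ≡ edge (u j) → i ≡ j) → EulerCircuit G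
  closedWalk⇒EulerCircuit u per consec nr = record
    { t           = u
    ; periodic    = per
    ; consecutive = consec
    ; allEdges    = u-allEdges
    ; noRepeat    = nr
    ; allVertices = u-allVertices
    }
    where
    u-allEdges : ∀ e → ∃ λ i → i < m × edge (u i) ≡ e
    u-allEdges = injective⇒surjective (λ i → edge (u i)) (nr _ _)
    u-allVertices : ∀ v → ∃ λ i → vtx G (u i) ≡ v
    u-allVertices v with j , vj ← allVertices v
                    with i , _ , ei ← u-allEdges (edge (t j))
                    with same-edge⇒≡⊎flip (u i) (t j) ei
    ... | inj₁ eq = i , trans (cong (vtx G) eq) vj
    ... | inj₂ eq = suc i , trans (sym (consec i)) (trans (cong (vtx G) (trans (cong flip eq) (flip-involutive _))) vj)

  shift : ℕ → EulerCircuit G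
  shift k = closedWalk⇒EulerCircuit (λ i → t (i + k)) per (λ i → consecutive (i + k)) nr
    where
    per : ∀ i → t ((i + m) + k) ≡ t (i + k)
    per i = trans (cong t (solve 3 (λ i m k → (i :+ m) :+ k := (i :+ k) :+ m) refl i m k)) (periodic (i + k))
    nr : ∀ i j → i < m → j < m → edge (t (i + k)) ≡ edge (t (j + k)) → i ≡ j
    nr i j i< j< eq = begin
      i       ≡⟨ m<n⇒m%n≡m i< ⟨
      i % m   ≡⟨ +-cancelˡ-% m′ k i j (subst₂ (λ a b → a % m ≡ b % m) (+-comm i k) (+-comm j k)
                                        (edge-t-injective-% (i + k) (j + k) eq)) ⟩
      j % m   ≡⟨ m<n⇒m%n≡m j< ⟩
      j       ∎
      where open ≡-Reasoning

  -- Stepping by m′ ≡ -1 (mod m) runs through the circuit backwards.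
  reverse : ℕ → EulerCircuit G
  reverse c = closedWalk⇒EulerCircuit (λ i → flip (t (c + i * m′))) per consec nr
    where
    per : ∀ i → flip (t (c + (i + m) * m′)) ≡ flip (t (c + i * m′))
    per i = cong flip (trans (cong t (solve 3
                (λ c i m′ → c :+ (i :+ (con 1 :+ m′)) :* m′ := (c :+ i :* m′) :+ m′ :* (con 1 :+ m′))
                refl c i m′))
              (t-periodic (c + i * m′) m′))
    consec : ∀ i → hd G (flip (t (c + i * m′))) ≡ vtx G (flip (t (c + suc i * m′)))
    consec i = trans (cong (vtx G) (flip-involutive _)) (sym (trans (consecutive (c + suc i * m′))
      (cong (vtx G) (trans (cong t (solve 3
        (λ c i m′ → con 1 :+ (c :+ (m′ :+ i :* m′)) := (c :+ i :* m′) :+ (con 1 :+ m′)) refl c i m′))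
        (periodic (c + i * m′))))))
    nr : ∀ i j → i < m → j < m → edge (flip (t (c + i * m′))) ≡ edge (flip (t (c + j * m′))) → i ≡ j
    nr i j i< j< eq =
      *-m′-injective-% m′ i< j< (+-cancelˡ-% m′ c (i * m′) (j * m′) (edge-t-injective-% _ _ eq))

  module _ (E : Embedding G) where
    open FaceTracing E

    4≤numOrbits : HasFaceT E C → 4 ≤ numOrbits E
    4≤numOrbits (x , fixed , boundary) = numOrbits-≥ (x ∷ rev x ∷ x̄ ∷ rev x̄ ∷ [])
      ( (x↛rev-x ∷ x↛x̄ ∷ x↛rev-x̄ ∷ [])
      ∷ (rev-x↛x̄ ∷ rev-x↛rev-x̄ ∷ [])
      ∷ (x̄↛rev-x̄ ∷ [])
      ∷ [] ∷ [])
      where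
      x̄ : State E
      x̄ = (proj₁ x , not (proj₂ x))
      -- The face meets each edge once per period, so reaching the edge of t 0 means returning to x.
      returns : ∀ k → edge (proj₁ (iter (φ E) k x)) ≡ edge (t 0) → iter (φ E) k x ≡ x
      returns k eq = begin
        iter (φ E) k x       ≡⟨ iter-% (φ E) fixed k ⟩
        iter (φ E) (k % m) x
          ≡⟨ cong (λ j → iter (φ E) j x) (edge-t-injective-% k 0 (trans (cong edge (sym (boundary k))) eq)) ⟩
        x                    ∎
        where open ≡-Reasoning
      x↛x̄ : ¬ Orbit x x̄
      x↛x̄ (k , eq) =
        not-¬ refl (cong proj₂ (trans (sym (returns k (cong edge (trans (cong proj₁ eq) (boundary 0))))) eq))
      x↛rev-x̄ : ¬ Orbit x (rev x̄)
      x↛rev-x̄ (k , eq) = flip-≢ (proj₁ x) (sym (cong proj₁ (trans (sym (returns k edge≡)) eq)))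
        where
        edge≡ : edge (proj₁ (iter (φ E) k x)) ≡ edge (t 0)
        edge≡ = cong edge (trans (cong proj₁ eq) (cong flip (boundary 0)))
      x↛rev-x : ¬ Orbit x (rev x)
      x↛rev-x (k , eq) = orbit-avoids-rev k x eq
      x̄↛rev-x̄ : ¬ Orbit x̄ (rev x̄)
      x̄↛rev-x̄ (k , eq) = orbit-avoids-rev k x̄ eq
      rev-x↛x̄ : ¬ Orbit (rev x) x̄
      rev-x↛x̄ o = x↛rev-x̄ (Orbit-sym (subst (Orbit (rev x̄)) (rev-involutive x) (Orbit-rev o)))
      rev-x↛rev-x̄ : ¬ Orbit (rev x) (rev x̄)
      rev-x↛rev-x̄ o = x↛x̄ (Orbit-sym (subst₂ Orbit (rev-involutive x̄) (rev-involutive x) (Orbit-rev o)))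

-- The corners of an Euler circuit

module Corners {n m′} {G : Graph n (suc m′)} (T : EulerCircuit G) where
  open EulerCircuit T
  open Circuit T
  private
    m = suc m′

  position : Dart m → ℕ
  position x = proj₁ (allEdges (edge x))

  position< : ∀ x → position x < m
  position< x = proj₁ (proj₂ (allEdges (edge x)))

  edge-t-position : ∀ x → edge (t (position x)) ≡ edge x
  edge-t-position x = proj₂ (proj₂ (allEdges (edge x)))

  position-edge : ∀ {x y} → edge x ≡ edge y → position x ≡ position y
  position-edge eq = cong (λ e → proj₁ (allEdges e)) eq

  position-t : ∀ {c} → c < m → position (t c) ≡ c
  position-t {c} c< = noRepeat _ c (position< (t c)) c< (edge-t-position (t c))

  prev : ℕ → ℕ
  prev zero    = m′
  prev (suc c) = c

  prev< : ∀ {c} → c < m → prev c < m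
  prev< {zero}  _  = ≤-refl
  prev< {suc c} c< = <-trans (n<1+n c) c<

  -- Corner c of T lies at vtx G (t c): T arrives there along flip (a c) and leaves along b c;
  -- MT, the transition system of T, swaps a c and b c.
  a : ℕ → Dart m
  a c = flip (t (prev c))

  b : ℕ → Dart m
  b = t

  position-a : ∀ {c} → c < m → position (a c) ≡ prev c
  position-a c< = position-t (prev< c<)

  prev-injective : ∀ {c c′} → c < m → c′ < m → prev c ≡ prev c′ → c ≡ c′
  prev-injective {zero}  {zero}   _  _         _  = refl
  prev-injective {zero}  {suc c′} _  (s≤s c′<) eq = ⊥-elim (<-irrefl (sym eq) c′<)
  prev-injective {suc c} {zero}   (s≤s c<) _   eq = ⊥-elim (<-irrefl eq c<)
  prev-injective {suc c} {suc c′} _  _         eq = cong suc eq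

  b-injective : ∀ {c c′} → c < m → c′ < m → b c ≡ b c′ → c ≡ c′
  b-injective c< c′< eq = trans (sym (position-t c<)) (trans (cong position eq) (position-t c′<))

  a-injective : ∀ {c c′} → c < m → c′ < m → a c ≡ a c′ → c ≡ c′
  a-injective c< c′< eq =
    prev-injective c< c′< (trans (sym (position-a c<)) (trans (cong position eq) (position-a c′<)))

  a≢b : ∀ {c c′} → c < m → c′ < m → a c ≢ b c′
  a≢b {c} c< c′< eq with trans (sym (position-a c<)) (trans (cong position eq) (position-t c′<))
  ... | refl = flip-≢ (t (prev c)) eq

  vtx-a : ∀ c → vtx G (a c) ≡ vtx G (b c)
  vtx-a zero    = trans (consecutive m′) (cong (vtx G) (periodic 0))
  vtx-a (suc c) = consecutive c

  data CornerView (x : Dart m) : Set where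
    is-b : ∀ c → c < m → x ≡ b c → CornerView x
    is-a : ∀ c → c < m → x ≡ a c → CornerView x

  cornerView : ∀ x → CornerView x
  cornerView x with same-edge⇒≡⊎flip x (t (position x)) (sym (edge-t-position x))
  ... | inj₁ eq = is-b (position x) (position< x) eq
  ... | inj₂ eq with m≤n⇒m<n∨m≡n (position< x)
  ...   | inj₁ lt   = is-a (suc (position x)) lt eq
  ...   | inj₂ last = is-a 0 (s≤s z≤n) (trans eq (cong (λ c → flip (t c)) (suc-injective last)))

  corner : Dart m → ℕ
  corner x with cornerView x
  ... | is-b c _ _ = c
  ... | is-a c _ _ = c

  corner< : ∀ x → corner x < m
  corner< x with cornerView x
  ... | is-b _ c< _ = c<
  ... | is-a _ c< _ = c<

  corner-b : ∀ {c} → c < m → corner (b c) ≡ c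
  corner-b {c} c< with cornerView (b c)
  ... | is-b c′ c′< eq = sym (b-injective c< c′< eq)
  ... | is-a c′ c′< eq = ⊥-elim (a≢b c′< c< (sym eq))

  corner-a : ∀ {c} → c < m → corner (a c) ≡ c
  corner-a {c} c< with cornerView (a c)
  ... | is-b c′ c′< eq = ⊥-elim (a≢b c< c′< eq)
  ... | is-a c′ c′< eq = sym (a-injective c< c′< eq)

  at-corner : ∀ x → x ≡ a (corner x) ⊎ x ≡ b (corner x)
  at-corner x with cornerView x
  ... | is-b _ _ eq = inj₂ eq
  ... | is-a _ _ eq = inj₁ eq

  vtx-corner : ∀ x → vtx G x ≡ vtx G (t (corner x))
  vtx-corner x with cornerView x
  ... | is-b c _ refl = refl
  ... | is-a c _ refl = vtx-a c

  corner≤1+position : ∀ x → corner x ≤ suc (position x)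
  corner≤1+position x with cornerView x
  ... | is-b c c< refl = ≤-trans (≤-reflexive (sym (position-t c<))) (n≤1+n _)
  ... | is-a zero    c< refl = z≤n
  ... | is-a (suc c) c< refl = s≤s (≤-reflexive (sym (position-a c<)))

  MT : Dart m → Dart m
  MT x with cornerView x
  ... | is-b c _ _ = a c
  ... | is-a c _ _ = b c

  MT-b : ∀ {c} → c < m → MT (b c) ≡ a c
  MT-b {c} c< with cornerView (b c)
  ... | is-b c′ c′< eq = cong a (sym (b-injective c< c′< eq))
  ... | is-a c′ c′< eq = ⊥-elim (a≢b c′< c< (sym eq))

  MT-a : ∀ {c} → c < m → MT (a c) ≡ b c
  MT-a {c} c< with cornerView (a c)
  ... | is-b c′ c′< eq = ⊥-elim (a≢b c< c′< eq)
  ... | is-a c′ c′< eq = cong b (sym (a-injective c< c′< eq))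

  MT-involutive : ∀ x → MT (MT x) ≡ x
  MT-involutive x with cornerView x
  ... | is-b c c< refl = MT-a c<
  ... | is-a c c< refl = MT-b c<

  corner-MT : ∀ x → corner (MT x) ≡ corner x
  corner-MT x with cornerView x
  ... | is-b c c< refl = corner-a c<
  ... | is-a c c< refl = corner-b c<

  vtx-MT : ∀ x → vtx G (MT x) ≡ vtx G x
  vtx-MT x with cornerView x
  ... | is-b c _ refl = vtx-a c
  ... | is-a c _ refl = sym (vtx-a c)

  same-corner : ∀ x y → corner x ≡ corner y → y ≡ x ⊎ y ≡ MT x
  same-corner x y eq with at-corner x | at-corner y
  ... | inj₁ ex | inj₁ ey = inj₁ (trans ey (trans (cong a (sym eq)) (sym ex)))
  ... | inj₂ ex | inj₂ ey = inj₁ (trans ey (trans (cong b (sym eq)) (sym ex)))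
  ... | inj₁ ex | inj₂ ey = inj₂ (trans ey (trans (cong b (sym eq)) (sym (trans (cong MT ex) (MT-a (corner< x))))))
  ... | inj₂ ex | inj₁ ey = inj₂ (trans ey (trans (cong a (sym eq)) (sym (trans (cong MT ex) (MT-b (corner< x))))))

  MT-flip-t< : ∀ {r} → r < m → MT (flip (t r)) ≡ t (suc r)
  MT-flip-t< {r} r< with m≤n⇒m<n∨m≡n r<
  ... | inj₁ r+1<m = MT-a r+1<m
  ... | inj₂ refl  = trans (MT-a (s≤s z≤n)) (sym (periodic 0))

  MT-flip-t : ∀ i → MT (flip (t i)) ≡ t (suc i)
  MT-flip-t i = begin
    MT (flip (t i))              ≡⟨ cong (MT ∘ flip) (t-% i) ⟩
    MT (flip (t (i % m)))        ≡⟨ MT-flip-t< (m%n<n i m) ⟩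
    t (suc (i % m))              ≡⟨ t-periodic (suc (i % m)) (i / m) ⟨
    t (suc (i % m + i / m * m))  ≡⟨ cong (t ∘ suc) (m≡m%n+[m/n]*n i m) ⟨
    t (suc i)                    ∎
    where open ≡-Reasoning

  walk-along : ∀ i k → Walk G (vtx G (t i)) (vtx G (t (i + k)))
  walk-along i zero    = subst (λ j → Walk G (vtx G (t i)) (vtx G (t j))) (sym (+-identityʳ i)) nil
  walk-along i (suc k) = subst (λ j → Walk G (vtx G (t i)) (vtx G (t j))) (sym (+-suc i k))
    (cons (t i) (subst (λ u → Walk G u (vtx G (t (suc i + k)))) (sym (consecutive i)) (walk-along (suc i) k)))

  connected : Connected G
  connected u v with i , refl ← allVertices u | j , refl ← allVertices v =
    subst (λ c → Walk G (vtx G (t i)) (vtx G c)) (trans (cong t i+[j+i*m′]≡j+i*m) (t-periodic j i))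
          (walk-along i (j + i * m′))
    where
    open +-*-Solver
    i+[j+i*m′]≡j+i*m : i + (j + i * m′) ≡ j + i * m
    i+[j+i*m′]≡j+i*m = solve 3 (λ i j m′ → i :+ (j :+ i :* m′) := j :+ i :* (con 1 :+ m′)) refl i j m′

  FreshVertices : ℕ → Set
  FreshVertices i = ∀ c c′ → c′ < c → c < i → vtx G (t c′) ≢ vtx G (t c)

  -- A circuit through each vertex once: the darts at the vertex of corner c are just a c and b c.
  fresh⇒cycle : FreshVertices m → IsCycle G
  fresh⇒cycle fresh = connected , degree≡2
    where
    degree≡2 : ∀ v → degree G v ≡ 2
    degree≡2 v with j , vj ← allVertices v = ≤-antisym
      (unique-⊆⇒length≤ (Unique.filter⁺ (T? ∘ at-v) (allDarts-unique m)) at-v⊆)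
      (unique-⊆⇒length≤ ((a≢b c< c< ∷ []) ∷ [] ∷ []) ⊆at-v)
      where
      c = j % m
      c< : c < m
      c< = m%n<n j m
      vc : vtx G (t c) ≡ v
      vc = trans (cong (vtx G) (sym (t-% j))) vj
      at-v : Dart m → Bool
      at-v d = does (vtx G d ≟ᶠ v)
      corner≡c : ∀ x → vtx G x ≡ v → corner x ≡ c
      corner≡c x vx with <-cmp (corner x) c
      ... | tri< lt _ _ = ⊥-elim (fresh c (corner x) lt c< (trans (sym (vtx-corner x)) (trans vx (sym vc))))
      ... | tri≈ _ eq _ = eq
      ... | tri> _ _ gt = ⊥-elim (fresh (corner x) c gt (corner< x) (trans vc (trans (sym vx) (vtx-corner x))))
      at-v⊆ : ∀ {x} → x ∈ filterᵇ at-v (allDarts m) → x ∈ a c ∷ b c ∷ []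
      at-v⊆ {x} x∈ with vx ← T-does⇒ (vtx G x ≟ᶠ v) (proj₂ (∈-filter⁻ (T? ∘ at-v) {xs = allDarts m} x∈))
                   with at-corner x
      ... | inj₁ eq = here (trans eq (cong a (corner≡c x vx)))
      ... | inj₂ eq = there (here (trans eq (cong b (corner≡c x vx))))
      ⊆at-v : ∀ {x} → x ∈ a c ∷ b c ∷ [] → x ∈ filterᵇ at-v (allDarts m)
      ⊆at-v (here refl)         =
        ∈-filter⁺ (T? ∘ at-v) (allDarts-complete _) (⇒T-does (vtx G (a c) ≟ᶠ v) (trans (vtx-a c) vc))
      ⊆at-v (there (here refl)) =
        ∈-filter⁺ (T? ∘ at-v) (allDarts-complete _) (⇒T-does (vtx G (b c) ≟ᶠ v) vc)

-- A second transition system, built along T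

module Construction {n m′} {G : Graph n (suc m′)} (T : EulerCircuit G) where
  open EulerCircuit T
  open Corners T
  private
    m = suc m′
    D = Dart m

  rotation : (D → Bool) → (D → D) → D → D
  rotation β MW x = if β x then MW x else MT x

  rotation-true : ∀ β MW x → β x ≡ true → rotation β MW x ≡ MW x
  rotation-true β MW x eq rewrite eq = refl

  rotation-false : ∀ β MW x → β x ≡ false → rotation β MW x ≡ MT x
  rotation-false β MW x eq rewrite eq = refl

  DistinctEdges : List D → Set
  DistinctEdges = AllPairs (λ x y → edge x ≢ edge y)

  WalkStep : (D → D) → D → D → Set
  WalkStep MW y z = MW (flip y) ≡ z

  prefix : ℕ → List D
  prefix zero    = []
  prefix (suc i) = prefix i ∷ʳ t i

  -- Once the corners 0 … i-1 of T are processed, W is a trail through exactly the edges of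
  -- t 0, …, t (i-1), entered from t m′ and ending with t (i-1), each of whose steps follows the
  -- transition system MW; and rotating by MW or MT, as β dictates, is a single cycle on the
  -- darts of the processed corners at each vertex.
  record Stage (i : ℕ) : Set where
    field
      W                  : List D
      β                  : D → Bool
      MW                 : D → D
      W-length           : length W ≡ i
      W-distinct         : DistinctEdges W
      W-position         : ∀ {x} → x ∈ W → position x < i
      W-corner           : ∀ {x} → x ∈ W → corner x < i
      W-covers           : ∀ j → j < i → ∃ λ x → x ∈ W × edge x ≡ edge (t j)
      W-linked           : Linked (WalkStep MW) (t m′ ∷ W)
      W-last             : ∃ λ W′ → W ≡ W′ ∷ʳ t (pred i)
      MW-involutive      : ∀ x → MW (MW x) ≡ x
      vtx-MW             : ∀ x → vtx G (MW x) ≡ vtx G x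
      MW-unprocessed     : ∀ x → i ≤ corner x → MW x ≡ MT x
      β-MW               : ∀ x → β (MW x) ≡ not (β x)
      β-MT               : ∀ x → β (MT x) ≡ not (β x)
      rotation-connected : ∀ x y → corner x < i → corner y < i → vtx G x ≡ vtx G y →
                           Reach (rotation β MW) x y

  -- Two corners at one vertex whose a-darts got different colours: this rules out orientability.
  Twist : ∀ {i} → Stage i → Set
  Twist {i} S = ∃₂ λ c c′ → c < i × c′ < i × vtx G (t c) ≡ vtx G (t c′)
                         × Stage.β S (a c) ≢ Stage.β S (a c′)

  Progress : ℕ → Set
  Progress i = Σ (Stage i) λ S → Twist S ⊎ (Stage.W S ≡ prefix i × FreshVertices i)

  module StageFacts {i} (S : Stage i) where
    open Stage S

    corner-MW< : ∀ x → corner x < i → corner (MW x) < i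
    corner-MW< x cx with corner (MW x) <? i
    ... | yes lt = lt
    ... | no ≮i  = ⊥-elim (<⇒≱ cx (subst (i ≤_) same (≮⇒≥ ≮i)))
      where
      same : corner (MW x) ≡ corner x
      same = trans (sym (corner-MT (MW x)))
                   (cong corner (trans (sym (MW-unprocessed (MW x) (≮⇒≥ ≮i))) (MW-involutive x)))

    corner-rotation< : ∀ x → corner x < i → corner (rotation β MW x) < i
    corner-rotation< x cx with β x
    ... | true  = corner-MW< x cx
    ... | false = subst (_< i) (sym (corner-MT x)) cx

    rotation-unprocessed : ∀ x → i ≤ corner x → rotation β MW x ≡ MT x
    rotation-unprocessed x i≤ with β x
    ... | true  = MW-unprocessed x i≤
    ... | false = refl

  same-corner-reach : ∀ β MW x y → (∀ z → corner z ≡ corner x → rotation β MW z ≡ MT z) →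
                      corner x ≡ corner y → Reach (rotation β MW) x y
  same-corner-reach β MW x y atMT eq with same-corner x y eq
  ... | inj₁ refl = 0 , refl
  ... | inj₂ refl = 1 , atMT x refl

  module Initial where
    β₀ : D → Bool
    β₀ x with cornerView x
    ... | is-b _ _ _ = false
    ... | is-a _ _ _ = true

    β₀-a : ∀ {c} → c < m → β₀ (a c) ≡ true
    β₀-a {c} c< with cornerView (a c)
    ... | is-b _ c′< eq = ⊥-elim (a≢b c< c′< eq)
    ... | is-a _ _   _  = refl

    β₀-b : ∀ {c} → c < m → β₀ (b c) ≡ false
    β₀-b {c} c< with cornerView (b c)
    ... | is-b _ _   _  = refl
    ... | is-a _ c′< eq = ⊥-elim (a≢b c′< c< (sym eq))

    β₀-MT : ∀ x → β₀ (MT x) ≡ not (β₀ x)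
    β₀-MT x with cornerView x
    ... | is-b c c< refl = β₀-a c<
    ... | is-a c c< refl = β₀-b c<

    stage : Stage 1
    stage = record
      { W                  = [ t 0 ]
      ; β                  = β₀
      ; MW                 = MT
      ; W-length           = refl
      ; W-distinct         = [] ∷ []
      ; W-position         = λ { (here refl) → s≤s (≤-reflexive (position-t (s≤s z≤n))) }
      ; W-corner           = λ { (here refl) → s≤s (≤-reflexive (corner-b (s≤s z≤n))) }
      ; W-covers           = λ { zero _ → t 0 , here refl , refl ; (suc j) (s≤s ()) }
      ; W-linked           = MT-a (s≤s z≤n) ∷ [-]
      ; W-last             = [] , refl
      ; MW-involutive      = MT-involutive
      ; vtx-MW             = vtx-MT
      ; MW-unprocessed     = λ _ _ → refl
      ; β-MW               = β₀-MT
      ; β-MT               = β₀-MT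
      ; rotation-connected = λ x y cx cy _ →
          same-corner-reach β₀ MT x y (λ z _ → if-same (β₀ z)) (trans (n<1⇒n≡0 cx) (sym (n<1⇒n≡0 cy)))
      }
      where
      if-same : ∀ c {x : D} → (if c then x else x) ≡ x
      if-same true  = refl
      if-same false = refl

    progress : Progress 1
    progress = stage , inj₂ (refl , λ { c c′ c′<c (s≤s z≤n) → ⊥-elim (n≮0 c′<c) })

  Twist-mono : ∀ {i j} (S : Stage i) (S′ : Stage j) → i ≤ j →
               (∀ c → c < i → Stage.β S′ (a c) ≡ Stage.β S (a c)) → Twist S → Twist S′
  Twist-mono S S′ i≤j same (c , c′ , c< , c′< , vcc′ , differ) =
    c , c′ , <-≤-trans c< i≤j , <-≤-trans c′< i≤j , vcc′ ,
    λ eq → differ (trans (sym (same c c<)) (trans eq (same c′ c′<)))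

  module FirstVisit {k} (k< : suc k < m) (S : Stage (suc k))
                    (fresh : ∀ f → f < suc k → vtx G (t f) ≢ vtx G (t (suc k))) where
    open Stage S
    open StageFacts S

    W′ : List D
    W′ = W ∷ʳ t (suc k)

    old≢new : ∀ {x} → x ∈ W → edge x ≢ edge (t (suc k))
    old≢new {x} x∈ eq = <-irrefl (trans (position-edge {x} {t (suc k)} eq) (position-t k<)) (W-position x∈)

    W′-distinct : DistinctEdges W′
    W′-distinct = AllPairs-++⁺ W-distinct ([] ∷ []) λ where
      x∈ (here refl) → old≢new x∈

    W′-position : ∀ {x} → x ∈ W′ → position x < suc (suc k)
    W′-position x∈ with ∈-++⁻ W x∈
    ... | inj₁ x∈W       = m<n⇒m<1+n (W-position x∈W)
    ... | inj₂ (here refl) = s≤s (≤-reflexive (position-t k<))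

    W′-corner : ∀ {x} → x ∈ W′ → corner x < suc (suc k)
    W′-corner x∈ with ∈-++⁻ W x∈
    ... | inj₁ x∈W       = m<n⇒m<1+n (W-corner x∈W)
    ... | inj₂ (here refl) = s≤s (≤-reflexive (corner-b k<))

    W′-covers : ∀ j → j < suc (suc k) → ∃ λ x → x ∈ W′ × edge x ≡ edge (t j)
    W′-covers j j< with <-suc-cases j<
    ... | inj₁ j<    = let x , x∈ , eq = W-covers j j< in x , ∈-++⁺ˡ x∈ , eq
    ... | inj₂ refl  = t (suc k) , ∈-++⁺ʳ W (here refl) , refl

    W′-linked : Linked (WalkStep MW) (t m′ ∷ W′)
    W′-linked with W″ , W≡ ← W-last =
      subst (λ L → Linked (WalkStep MW) (t m′ ∷ L ∷ʳ t (suc k))) (sym W≡)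
        (Linked-∷ʳ (t m′ ∷ W″) (t k) (t (suc k))
          (subst (λ L → Linked (WalkStep MW) (t m′ ∷ L)) W≡ W-linked)
          (trans (MW-unprocessed (a (suc k)) (≤-reflexive (sym (corner-a k<)))) (MT-a k<)))

    connected′ : ∀ x y → corner x < suc (suc k) → corner y < suc (suc k) → vtx G x ≡ vtx G y →
                 Reach (rotation β MW) x y
    connected′ x y cx cy vxy with <-suc-cases cx | <-suc-cases cy
    ... | inj₁ cx< | inj₁ cy< = rotation-connected x y cx< cy< vxy
    ... | inj₁ cx< | inj₂ cy≡ = ⊥-elim (fresh (corner x) cx<
          (trans (sym (vtx-corner x)) (trans vxy (trans (vtx-corner y) (cong (λ c → vtx G (t c)) cy≡)))))
    ... | inj₂ cx≡ | inj₁ cy< = ⊥-elim (fresh (corner y) cy<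
          (trans (sym (vtx-corner y)) (trans (sym vxy) (trans (vtx-corner x) (cong (λ c → vtx G (t c)) cx≡)))))
    ... | inj₂ cx≡ | inj₂ cy≡ = same-corner-reach β MW x y
          (λ z cz → rotation-unprocessed z (≤-reflexive (sym (trans cz cx≡)))) (trans cx≡ (sym cy≡))

    stage : Stage (suc (suc k))
    stage = record
      { W                  = W′
      ; β                  = β
      ; MW                 = MW
      ; W-length           = trans (length-++ W) (trans (cong (_+ 1) W-length) (+-comm (suc k) 1))
      ; W-distinct         = W′-distinct
      ; W-position         = W′-position
      ; W-corner           = W′-corner
      ; W-covers           = W′-covers
      ; W-linked           = W′-linked
      ; W-last             = W , refl
      ; MW-involutive      = MW-involutive
      ; vtx-MW             = vtx-MW
      ; MW-unprocessed     = λ x le → MW-unprocessed x (≤-trans (n≤1+n (suc k)) le)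
      ; β-MW               = β-MW
      ; β-MT               = β-MT
      ; rotation-connected = connected′
      }

  extend : ∀ {k} → suc k < m → Progress (suc k) → (∀ f → f < suc k → vtx G (t f) ≢ vtx G (t (suc k))) →
           Progress (suc (suc k))
  extend {k} k< (S , witness) fresh = stage , extend-witness witness
    where
    open FirstVisit k< S fresh
    extend-witness : Twist S ⊎ (Stage.W S ≡ prefix (suc k) × FreshVertices (suc k)) →
                     Twist stage ⊎ (W′ ≡ prefix (suc (suc k)) × FreshVertices (suc (suc k)))
    extend-witness (inj₁ twist)          = inj₁ (Twist-mono S stage (n≤1+n _) (λ _ _ → refl) twist)
    extend-witness (inj₂ (W≡ , earlier)) =
      inj₂ (cong (_∷ʳ t _) W≡ , λ c c′ c′<c c< → case <-suc-cases c< of λ where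
        (inj₁ c<)   → earlier c c′ c′<c c<
        (inj₂ refl) → fresh c′ c′<c)

  -- A revisited vertex: the walk passes it at z, entering along ℓ.  The new corner is spliced
  -- in by reversing the part of W after ℓ, so that W runs ℓ, a⁺, …, flip z, b⁺.
  module Splice {k} (k< : suc k < m) (S : Stage (suc k)) (P Q A : List D) (ℓ z : D)
                (W≡ : Stage.W S ≡ P ++ z ∷ Q) (ℓ-last : t m′ ∷ P ≡ A ∷ʳ ℓ)
                (vtx-z : vtx G z ≡ vtx G (t (suc k))) where
    open Stage S
    open StageFacts S

    p a⁺ b⁺ : D
    p  = flip ℓ
    a⁺ = a (suc k)
    b⁺ = b (suc k)

    processed≢ : ∀ {x y} → corner x < suc k → corner y ≡ suc k → x ≢ y
    processed≢ cx cy refl = <-irrefl cy cx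

    corner-a⁺ : corner a⁺ ≡ suc k
    corner-a⁺ = corner-a k<

    corner-b⁺ : corner b⁺ ≡ suc k
    corner-b⁺ = corner-b k<

    MW-a⁺ : MW a⁺ ≡ b⁺
    MW-a⁺ = trans (MW-unprocessed a⁺ (≤-reflexive (sym corner-a⁺))) (MT-a k<)

    MW-b⁺ : MW b⁺ ≡ a⁺
    MW-b⁺ = trans (MW-unprocessed b⁺ (≤-reflexive (sym corner-b⁺))) (MT-b k<)

    a⁺≢b⁺ : a⁺ ≢ b⁺
    a⁺≢b⁺ = a≢b k< k<

    t-m′∷W≡ : t m′ ∷ W ≡ A ++ ℓ ∷ z ∷ Q
    t-m′∷W≡ = begin
      t m′ ∷ W             ≡⟨ cong (t m′ ∷_) W≡ ⟩
      (t m′ ∷ P) ++ z ∷ Q  ≡⟨ cong (_++ z ∷ Q) ℓ-last ⟩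
      (A ∷ʳ ℓ) ++ z ∷ Q    ≡⟨ ++-assoc A [ ℓ ] (z ∷ Q) ⟩
      A ++ ℓ ∷ z ∷ Q       ∎
      where open ≡-Reasoning

    linked-split : Linked (WalkStep MW) (A ∷ʳ ℓ) × Linked (WalkStep MW) (ℓ ∷ z ∷ Q)
    linked-split = Linked-split A ℓ (z ∷ Q) (subst (Linked (WalkStep MW)) t-m′∷W≡ W-linked)

    MW-p : MW p ≡ z
    MW-p with _ , step ∷ _ ← linked-split = step

    MW-z : MW z ≡ p
    MW-z = trans (cong MW (sym MW-p)) (MW-involutive p)

    z∈W : z ∈ W
    z∈W = subst (z ∈_) (sym W≡) (∈-++⁺ʳ P (here refl))

    corner-z : corner z < suc k
    corner-z = W-corner z∈W

    corner-p : corner p < suc k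
    corner-p = subst (λ x → corner x < suc k) MW-z (corner-MW< z corner-z)

    vtx-p : vtx G p ≡ vtx G (t (suc k))
    vtx-p = trans (cong (vtx G) (sym MW-z)) (trans (vtx-MW z) vtx-z)

    β-z : β z ≡ not (β p)
    β-z = trans (cong β (sym MW-p)) (β-MW p)

    p≢z : p ≢ z
    p≢z eq = not-¬ refl (trans (cong β eq) β-z)

    -- z and a⁺ lie at the same vertex, so conjugating MW by their transposition keeps it a
    -- vertex-preserving involution; it re-pairs p with a⁺ and z with b⁺.
    τ : D → D
    τ = transpose _≟ᵈ_ z a⁺

    MW′ : D → D
    MW′ x = τ (MW (τ x))

    τ-other : ∀ {x} → x ≢ z → x ≢ a⁺ → τ x ≡ x
    τ-other = transpose-other _≟ᵈ_ z a⁺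

    MW′-involutive : ∀ x → MW′ (MW′ x) ≡ x
    MW′-involutive x = begin
      τ (MW (τ (τ (MW (τ x))))) ≡⟨ cong (τ ∘ MW) (transpose-involutive _≟ᵈ_ z a⁺ (MW (τ x))) ⟩
      τ (MW (MW (τ x)))         ≡⟨ cong τ (MW-involutive (τ x)) ⟩
      τ (τ x)                   ≡⟨ transpose-involutive _≟ᵈ_ z a⁺ x ⟩
      x                         ∎
      where open ≡-Reasoning

    vtx-MW′ : ∀ x → vtx G (MW′ x) ≡ vtx G x
    vtx-MW′ x = begin
      vtx G (τ (MW (τ x))) ≡⟨ vtx-τ (MW (τ x)) ⟩
      vtx G (MW (τ x))     ≡⟨ vtx-MW (τ x) ⟩
      vtx G (τ x)          ≡⟨ vtx-τ x ⟩
      vtx G x              ∎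
      where
      open ≡-Reasoning
      vtx-τ : ∀ y → vtx G (τ y) ≡ vtx G y
      vtx-τ = transpose-resp _≟ᵈ_ z a⁺ (vtx G) (trans vtx-z (sym (vtx-a (suc k))))

    MW′-p : MW′ p ≡ a⁺
    MW′-p = trans (cong (τ ∘ MW) (τ-other p≢z (processed≢ corner-p corner-a⁺)))
                  (trans (cong τ MW-p) (transpose-u _≟ᵈ_ z a⁺))

    MW′-a⁺ : MW′ a⁺ ≡ p
    MW′-a⁺ = trans (cong (τ ∘ MW) (transpose-v _≟ᵈ_ z a⁺))
                   (trans (cong τ MW-z) (τ-other p≢z (processed≢ corner-p corner-a⁺)))

    MW′-z : MW′ z ≡ b⁺
    MW′-z = trans (cong (τ ∘ MW) (transpose-u _≟ᵈ_ z a⁺))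
                  (trans (cong τ MW-a⁺) (τ-other (processed≢ corner-z corner-b⁺ ∘ sym) (a⁺≢b⁺ ∘ sym)))

    MW′-b⁺ : MW′ b⁺ ≡ z
    MW′-b⁺ = trans (cong (τ ∘ MW) (τ-other (processed≢ corner-z corner-b⁺ ∘ sym) (a⁺≢b⁺ ∘ sym)))
                   (trans (cong τ MW-b⁺) (transpose-v _≟ᵈ_ z a⁺))

    MW′-other : ∀ {x} → x ≢ p → x ≢ z → x ≢ a⁺ → x ≢ b⁺ → MW′ x ≡ MW x
    MW′-other {x} x≢p x≢z x≢a⁺ x≢b⁺ = trans (cong (τ ∘ MW) (τ-other x≢z x≢a⁺)) (τ-other
      (λ eq → x≢p (trans (sym (MW-involutive x)) (trans (cong MW eq) MW-z)))
      (λ eq → x≢b⁺ (trans (sym (MW-involutive x)) (trans (cong MW eq) MW-a⁺))))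

    data Spot (x : D) : Set where
      at-p      : x ≡ p → Spot x
      at-z      : x ≡ z → Spot x
      at-a⁺     : x ≡ a⁺ → Spot x
      at-b⁺     : x ≡ b⁺ → Spot x
      elsewhere : x ≢ p → x ≢ z → x ≢ a⁺ → x ≢ b⁺ → Spot x

    spot : ∀ x → Spot x
    spot x with x ≟ᵈ p | x ≟ᵈ z | x ≟ᵈ a⁺ | x ≟ᵈ b⁺
    ... | yes x≡p | _       | _        | _        = at-p x≡p
    ... | no _    | yes x≡z | _        | _        = at-z x≡z
    ... | no _    | no _    | yes x≡a⁺ | _        = at-a⁺ x≡a⁺
    ... | no _    | no _    | no _     | yes x≡b⁺ = at-b⁺ x≡b⁺
    ... | no x≢p  | no x≢z  | no x≢a⁺  | no x≢b⁺  = elsewhere x≢p x≢z x≢a⁺ x≢b⁺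

    MW′-unprocessed : ∀ x → suc (suc k) ≤ corner x → MW′ x ≡ MT x
    MW′-unprocessed x le = trans
      (MW′-other (far (m<n⇒m<1+n corner-p)) (far (m<n⇒m<1+n corner-z))
                 (far (s≤s (≤-reflexive corner-a⁺))) (far (s≤s (≤-reflexive corner-b⁺))))
      (MW-unprocessed x (≤-trans (n≤1+n _) le))
      where
      far : ∀ {y} → corner y < suc (suc k) → x ≢ y
      far cy refl = <⇒≱ cy le

    new-corner? : ∀ x → x ≡ a⁺ ⊎ x ≡ b⁺ ⊎ (x ≢ a⁺ × x ≢ b⁺)
    new-corner? x with x ≟ᵈ a⁺ | x ≟ᵈ b⁺
    ... | yes x≡a⁺ | _        = inj₁ x≡a⁺
    ... | no _     | yes x≡b⁺ = inj₂ (inj₁ x≡b⁺)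
    ... | no x≢a⁺  | no x≢b⁺  = inj₂ (inj₂ (x≢a⁺ , x≢b⁺))

    β′ : D → Bool
    β′ x with x ≟ᵈ a⁺ | x ≟ᵈ b⁺
    ... | yes _ | _     = not (β p)
    ... | no _  | yes _ = β p
    ... | no _  | no _  = β x

    β′-a⁺ : β′ a⁺ ≡ not (β p)
    β′-a⁺ with a⁺ ≟ᵈ a⁺
    ... | yes _    = refl
    ... | no a⁺≢a⁺ = ⊥-elim (a⁺≢a⁺ refl)

    β′-b⁺ : β′ b⁺ ≡ β p
    β′-b⁺ with b⁺ ≟ᵈ a⁺ | b⁺ ≟ᵈ b⁺
    ... | yes b⁺≡a⁺ | _        = ⊥-elim (a⁺≢b⁺ (sym b⁺≡a⁺))
    ... | no _      | yes _    = refl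
    ... | no _      | no b⁺≢b⁺ = ⊥-elim (b⁺≢b⁺ refl)

    β′-other : ∀ {x} → x ≢ a⁺ → x ≢ b⁺ → β′ x ≡ β x
    β′-other {x} x≢a⁺ x≢b⁺ with x ≟ᵈ a⁺ | x ≟ᵈ b⁺
    ... | yes x≡a⁺ | _        = ⊥-elim (x≢a⁺ x≡a⁺)
    ... | no _     | yes x≡b⁺ = ⊥-elim (x≢b⁺ x≡b⁺)
    ... | no _     | no _     = refl

    β′-processed : ∀ x → corner x < suc k → β′ x ≡ β x
    β′-processed x cx = β′-other (processed≢ {x} cx corner-a⁺) (processed≢ {x} cx corner-b⁺)

    β′-p : β′ p ≡ β p
    β′-p = β′-processed p corner-p

    β′-z : β′ z ≡ not (β p)
    β′-z = trans (β′-processed z corner-z) β-z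

    β′-MW′ : ∀ x → β′ (MW′ x) ≡ not (β′ x)
    β′-MW′ x with spot x
    ... | at-p  refl = trans (cong β′ MW′-p) (trans β′-a⁺ (cong not (sym β′-p)))
    ... | at-z  refl =
      trans (cong β′ MW′-z) (trans β′-b⁺ (trans (sym (not-involutive _)) (cong not (sym β′-z))))
    ... | at-a⁺ refl =
      trans (cong β′ MW′-a⁺) (trans β′-p (trans (sym (not-involutive _)) (cong not (sym β′-a⁺))))
    ... | at-b⁺ refl = trans (cong β′ MW′-b⁺) (trans β′-z (cong not (sym β′-b⁺)))
    ... | elsewhere x≢p x≢z x≢a⁺ x≢b⁺ = begin
      β′ (MW′ x)    ≡⟨ cong β′ (MW′-other x≢p x≢z x≢a⁺ x≢b⁺) ⟩
      β′ (MW x)     ≡⟨ β′-other (λ eq → x≢b⁺ (MW-injective (trans eq (sym MW-b⁺))))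
                                (λ eq → x≢a⁺ (MW-injective (trans eq (sym MW-a⁺)))) ⟩
      β (MW x)      ≡⟨ β-MW x ⟩
      not (β x)     ≡⟨ cong not (β′-other x≢a⁺ x≢b⁺) ⟨
      not (β′ x)    ∎
      where
      open ≡-Reasoning
      MW-injective : ∀ {u v} → MW u ≡ MW v → u ≡ v
      MW-injective {u} {v} eq = trans (sym (MW-involutive u)) (trans (cong MW eq) (MW-involutive v))

    β′-MT : ∀ x → β′ (MT x) ≡ not (β′ x)
    β′-MT x with new-corner? x
    ... | inj₁ refl        =
      trans (cong β′ (MT-a k<)) (trans β′-b⁺ (trans (sym (not-involutive _)) (cong not (sym β′-a⁺))))
    ... | inj₂ (inj₁ refl) = trans (cong β′ (MT-b k<)) (trans β′-a⁺ (cong not (sym β′-b⁺)))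
    ... | inj₂ (inj₂ (x≢a⁺ , x≢b⁺)) = begin
      β′ (MT x)     ≡⟨ β′-other (λ eq → x≢b⁺ (MT-injective (trans eq (sym (MT-b k<)))))
                                (λ eq → x≢a⁺ (MT-injective (trans eq (sym (MT-a k<))))) ⟩
      β (MT x)      ≡⟨ β-MT x ⟩
      not (β x)     ≡⟨ cong not (β′-other x≢a⁺ x≢b⁺) ⟨
      not (β′ x)    ∎
      where
      open ≡-Reasoning
      MT-injective : ∀ {u v} → MT u ≡ MT v → u ≡ v
      MT-injective {u} {v} eq = trans (sym (MT-involutive u)) (trans (cong MT eq) (MT-involutive v))

    ρ ρ′ : D → D
    ρ  = rotation β MW
    ρ′ = rotation β′ MW′

    ρ-MW : ∀ x → β x ≡ true → ρ x ≡ MW x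
    ρ-MW x = rotation-true β MW x

    ρ-MT : ∀ x → β x ≡ false → ρ x ≡ MT x
    ρ-MT x = rotation-false β MW x

    ρ′-MW′ : ∀ x → β′ x ≡ true → ρ′ x ≡ MW′ x
    ρ′-MW′ x = rotation-true β′ MW′ x

    ρ′-MT : ∀ x → β′ x ≡ false → ρ′ x ≡ MT x
    ρ′-MT x = rotation-false β′ MW′ x

    one : ∀ x {y} → ρ′ x ≡ y → Reach ρ′ x y
    one x = Reach-step ρ′

    module _ (βp : β p ≡ true) where
      p→a⁺ : ρ′ p ≡ a⁺
      p→a⁺ = trans (ρ′-MW′ p (trans β′-p βp)) MW′-p

      a⁺→b⁺ : ρ′ a⁺ ≡ b⁺
      a⁺→b⁺ = trans (ρ′-MT a⁺ (trans β′-a⁺ (cong not βp))) (MT-a k<)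

      b⁺→z : ρ′ b⁺ ≡ z
      b⁺→z = trans (ρ′-MW′ b⁺ (trans β′-b⁺ βp)) MW′-b⁺

    module _ (βp : β p ≡ false) where
      z→b⁺ : ρ′ z ≡ b⁺
      z→b⁺ = trans (ρ′-MW′ z (trans β′-z (cong not βp))) MW′-z

      b⁺→a⁺ : ρ′ b⁺ ≡ a⁺
      b⁺→a⁺ = trans (ρ′-MT b⁺ (trans β′-b⁺ βp)) (MT-b k<)

      a⁺→p : ρ′ a⁺ ≡ p
      a⁺→p = trans (ρ′-MW′ a⁺ (trans β′-a⁺ (cong not βp))) MW′-a⁺

    -- Each old rotation step survives, possibly as a detour p → a⁺ → b⁺ → z or z → b⁺ → a⁺ → p.
    old-step : ∀ x → corner x < suc k → ∀ b → β x ≡ b → Reach ρ′ x (ρ x)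
    old-step x cx false βx = one x (trans (ρ′-MT x (trans (β′-processed x cx) βx)) (sym (ρ-MT x βx)))
    old-step x cx true  βx with spot x
    ... | at-p refl  = subst (Reach ρ′ p) (sym (trans (ρ-MW p βx) MW-p))
                         (Reach-trans ρ′ (one p (p→a⁺ βx))
                           (Reach-trans ρ′ (one a⁺ (a⁺→b⁺ βx)) (one b⁺ (b⁺→z βx))))
    ... | at-z refl  = subst (Reach ρ′ z) (sym (trans (ρ-MW z βx) MW-z))
                         (Reach-trans ρ′ (one z (z→b⁺ βp))
                           (Reach-trans ρ′ (one b⁺ (b⁺→a⁺ βp)) (one a⁺ (a⁺→p βp))))
      where
      βp : β p ≡ false
      βp = not-injective (trans (sym β-z) βx)
    ... | at-a⁺ refl = ⊥-elim (<-irrefl corner-a⁺ cx)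
    ... | at-b⁺ refl = ⊥-elim (<-irrefl corner-b⁺ cx)
    ... | elsewhere x≢p x≢z x≢a⁺ x≢b⁺ = one x (trans (ρ′-MW′ x (trans (β′-processed x cx) βx))
                                           (trans (MW′-other x≢p x≢z x≢a⁺ x≢b⁺) (sym (ρ-MW x βx))))

    lift : ∀ {x} j → corner x < suc k → Reach ρ′ x (iter ρ j x)
    lift zero    cx = 0 , refl
    lift (suc j) cx = Reach-trans ρ′ (lift j cx) (old-step _ (processed j cx) _ refl)
      where
      processed : ∀ {x} j → corner x < suc k → corner (iter ρ j x) < suc k
      processed zero    cx = cx
      processed (suc j) cx = corner-rotation< _ (processed j cx)

    old-reach : ∀ x y → corner x < suc k → corner y < suc k → vtx G x ≡ vtx G y → Reach ρ′ x y
    old-reach x y cx cy vxy with j , refl ← rotation-connected x y cx cy vxy = lift j cx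

    p↝z : Reach ρ′ p z
    p↝z = old-reach p z corner-p corner-z (trans vtx-p (sym vtx-z))

    z↝p : Reach ρ′ z p
    z↝p = old-reach z p corner-z corner-p (trans vtx-z (sym vtx-p))

    p↝new : ∀ b → β p ≡ b → Reach ρ′ p a⁺ × Reach ρ′ p b⁺
    p↝new true  βp = one p (p→a⁺ βp) , Reach-trans ρ′ (one p (p→a⁺ βp)) (one a⁺ (a⁺→b⁺ βp))
    p↝new false βp = Reach-trans ρ′ p↝b⁺ (one b⁺ (b⁺→a⁺ βp)) , p↝b⁺
      where
      p↝b⁺ : Reach ρ′ p b⁺
      p↝b⁺ = Reach-trans ρ′ p↝z (one z (z→b⁺ βp))

    new↝p : ∀ b → β p ≡ b → Reach ρ′ a⁺ p × Reach ρ′ b⁺ p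
    new↝p true  βp = Reach-trans ρ′ (one a⁺ (a⁺→b⁺ βp)) b⁺↝p , b⁺↝p
      where
      b⁺↝p : Reach ρ′ b⁺ p
      b⁺↝p = Reach-trans ρ′ (one b⁺ (b⁺→z βp)) z↝p
    new↝p false βp = one a⁺ (a⁺→p βp) , Reach-trans ρ′ (one b⁺ (b⁺→a⁺ βp)) (one a⁺ (a⁺→p βp))

    new-dart : ∀ x → corner x ≡ suc k → x ≡ a⁺ ⊎ x ≡ b⁺
    new-dart x cx with same-corner b⁺ x (trans corner-b⁺ (sym cx))
    ... | inj₁ x≡b⁺ = inj₂ x≡b⁺
    ... | inj₂ x≡MTb⁺ = inj₁ (trans x≡MTb⁺ (MT-b k<))

    ↝p : ∀ x → corner x < suc (suc k) → vtx G x ≡ vtx G (t (suc k)) → Reach ρ′ x p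
    ↝p x cx vx with <-suc-cases cx
    ... | inj₁ cx< = old-reach x p cx< corner-p (trans vx (sym vtx-p))
    ... | inj₂ cx≡ with new-dart x cx≡
    ...   | inj₁ refl = proj₁ (new↝p _ refl)
    ...   | inj₂ refl = proj₂ (new↝p _ refl)

    p↝ : ∀ x → corner x < suc (suc k) → vtx G x ≡ vtx G (t (suc k)) → Reach ρ′ p x
    p↝ x cx vx with <-suc-cases cx
    ... | inj₁ cx< = old-reach p x corner-p cx< (trans vtx-p (sym vx))
    ... | inj₂ cx≡ with new-dart x cx≡
    ...   | inj₁ refl = proj₁ (p↝new _ refl)
    ...   | inj₂ refl = proj₂ (p↝new _ refl)

    connected′ : ∀ x y → corner x < suc (suc k) → corner y < suc (suc k) → vtx G x ≡ vtx G y →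
                 Reach ρ′ x y
    connected′ x y cx cy vxy with <-suc-cases cx | <-suc-cases cy
    ... | inj₁ cx< | inj₁ cy< = old-reach x y cx< cy< vxy
    ... | inj₂ cx≡ | _        = Reach-trans ρ′ (↝p x cx vx) (p↝ y cy (trans (sym vxy) vx))
      where
      vx : vtx G x ≡ vtx G (t (suc k))
      vx = trans (vtx-corner x) (cong (λ c → vtx G (t c)) cx≡)
    ... | inj₁ _   | inj₂ cy≡ = Reach-trans ρ′ (↝p x cx (trans vxy vy)) (p↝ y cy vy)
      where
      vy : vtx G y ≡ vtx G (t (suc k))
      vy = trans (vtx-corner y) (cong (λ c → vtx G (t c)) cy≡)


    W-split : DistinctEdges P × DistinctEdges (z ∷ Q) ×
              (∀ {x y} → x ∈ P → y ∈ z ∷ Q → edge x ≢ edge y)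
    W-split = AllPairs-++⁻ P (subst DistinctEdges W≡ W-distinct)

    P⊆W : ∀ {x} → x ∈ P → x ∈ W
    P⊆W x∈ = subst (_ ∈_) (sym W≡) (∈-++⁺ˡ x∈)

    z∷Q⊆W : ∀ {x} → x ∈ z ∷ Q → x ∈ W
    z∷Q⊆W x∈ = subst (_ ∈_) (sym W≡) (∈-++⁺ʳ P x∈)

    segment-last : ∃ λ R → z ∷ Q ≡ R ∷ʳ t k
    segment-last with W‴ , W≡W‴ ← W-last = ∷ʳ-suffix P W‴ z Q (t k) (trans (sym W≡) W≡W‴)

    reversed : List D
    reversed = revMap flip (z ∷ Q)

    reversed-head : ∃ λ R′ → reversed ≡ a⁺ ∷ R′
    reversed-head with R , z∷Q≡ ← segment-last =
      revMap flip R , trans (cong (revMap flip) z∷Q≡) (revMap-∷ʳ flip R (t k))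

    W′ : List D
    W′ = P ++ reversed ∷ʳ b⁺

    ∈W′ : ∀ {x} → x ∈ W′ → x ∈ P ⊎ (∃ λ x₀ → x₀ ∈ z ∷ Q × x ≡ flip x₀) ⊎ x ≡ b⁺
    ∈W′ x∈ with ∈-++⁻ P x∈
    ... | inj₁ x∈P = inj₁ x∈P
    ... | inj₂ x∈ʳ with ∈-++⁻ reversed x∈ʳ
    ...   | inj₁ x∈rev       = inj₂ (inj₁ (∈-revMap⁻ flip (z ∷ Q) x∈rev))
    ...   | inj₂ (here refl) = inj₂ (inj₂ refl)

    position-b⁺ : position b⁺ ≡ suc k
    position-b⁺ = position-t k<

    old≢b⁺ : ∀ {x} → x ∈ W → edge x ≢ edge b⁺
    old≢b⁺ {x} x∈ eq = <-irrefl (trans (position-edge {x} {b⁺} eq) position-b⁺) (W-position x∈)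

    edge-reversed : ∀ {y} → y ∈ reversed → ∃ λ y₀ → y₀ ∈ z ∷ Q × edge y ≡ edge y₀
    edge-reversed y∈ with y₀ , y₀∈ , refl ← ∈-revMap⁻ flip (z ∷ Q) y∈ = y₀ , y₀∈ , refl

    W′-distinct : DistinctEdges W′
    W′-distinct = AllPairs-++⁺ (proj₁ W-split)
      (AllPairs-++⁺ (AllPairs-revMap flip (_∘ sym) (proj₁ (proj₂ W-split))) ([] ∷ []) λ where
        y∈ (here refl) eq → let y₀ , y₀∈ , e = edge-reversed y∈ in
          old≢b⁺ (z∷Q⊆W y₀∈) (trans (sym e) eq))
      λ x∈ y∈ eq → case ∈-++⁻ reversed y∈ of λ where
        (inj₁ y∈rev)       → let y₀ , y₀∈ , e = edge-reversed y∈rev in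
          proj₂ (proj₂ W-split) x∈ y₀∈ (trans eq e)
        (inj₂ (here refl)) → old≢b⁺ (P⊆W x∈) eq

    W′-position : ∀ {x} → x ∈ W′ → position x < suc (suc k)
    W′-position x∈ with ∈W′ x∈
    ... | inj₁ x∈P                      = m<n⇒m<1+n (W-position (P⊆W x∈P))
    ... | inj₂ (inj₁ (x₀ , x₀∈ , refl)) = m<n⇒m<1+n (W-position (z∷Q⊆W x₀∈))
    ... | inj₂ (inj₂ refl)              = s≤s (≤-reflexive position-b⁺)

    W′-corner : ∀ {x} → x ∈ W′ → corner x < suc (suc k)
    W′-corner x∈ with ∈W′ x∈
    ... | inj₁ x∈P                      = m<n⇒m<1+n (W-corner (P⊆W x∈P))
    ... | inj₂ (inj₁ (x₀ , x₀∈ , refl)) =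
      s≤s (≤-trans (corner≤1+position (flip x₀)) (W-position (z∷Q⊆W x₀∈)))
    ... | inj₂ (inj₂ refl)              = s≤s (≤-reflexive corner-b⁺)

    W′-covers : ∀ j → j < suc (suc k) → ∃ λ x → x ∈ W′ × edge x ≡ edge (t j)
    W′-covers j j< with <-suc-cases j<
    ... | inj₂ refl = b⁺ , ∈-++⁺ʳ P (∈-++⁺ʳ reversed (here refl)) , refl
    ... | inj₁ j<′ with x , x∈ , eq ← W-covers j j<′ with ∈-++⁻ P (subst (x ∈_) W≡ x∈)
    ...   | inj₁ x∈P  = x , ∈-++⁺ˡ x∈P , eq
    ...   | inj₂ x∈zQ = flip x , ∈-++⁺ʳ P (∈-++⁺ˡ (∈-revMap⁺ flip x∈zQ)) , eq

    W′-length : length W′ ≡ suc (suc k)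
    W′-length = begin
      length (P ++ reversed ∷ʳ b⁺)          ≡⟨ length-++ P ⟩
      length P + length (reversed ∷ʳ b⁺)    ≡⟨ cong (λ l → length P + l) (length-++ reversed) ⟩
      length P + (length reversed + 1)      ≡⟨ cong (λ l → length P + (l + 1)) (length-revMap flip (z ∷ Q)) ⟩
      length P + (length (z ∷ Q) + 1)       ≡⟨ +-assoc (length P) _ 1 ⟨
      length P + length (z ∷ Q) + 1
        ≡⟨ cong (_+ 1) (trans (sym (length-++ P)) (trans (cong length (sym W≡)) W-length)) ⟩
      suc k + 1                             ≡⟨ +-comm (suc k) 1 ⟩
      suc (suc k)                           ∎
      where open ≡-Reasoning

    step-transfer : ∀ {x y} → flip x ≢ z → y ≢ z × corner y < suc k → WalkStep MW x y → WalkStep MW′ x y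
    step-transfer {x} {y} fx≢z (y≢z , cy) step = begin
      τ (MW (τ (flip x))) ≡⟨ cong (τ ∘ MW) (τ-other fx≢z (processed≢ cfx corner-a⁺)) ⟩
      τ (MW (flip x))     ≡⟨ cong τ step ⟩
      τ y                 ≡⟨ τ-other y≢z (processed≢ cy corner-a⁺) ⟩
      y                   ∎
      where
      open ≡-Reasoning
      cfx : corner (flip x) < suc k
      cfx = subst (λ w → corner w < suc k) (trans (cong MW (sym step)) (MW-involutive (flip x))) (corner-MW< y cy)

    transfer : ∀ {x xs} → Linked (WalkStep MW) (x ∷ xs) → flip x ≢ z →
               All (λ y → edge y ≢ edge z × corner y < suc k) xs → Linked (WalkStep MW′) (x ∷ xs)
    transfer l fx≢z ok = Linked-transfer (λ x → flip x ≢ z) (λ y → y ≢ z × corner y < suc k)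
      (λ fx≢z _ q → step-transfer fx≢z q) l fx≢z
      (All.map (λ (e≢ , cy) → (λ eq → e≢ (cong edge eq)) , ((λ eq → e≢ (cong edge eq)) , cy)) ok)

    t-m′≢z : flip (t m′) ≢ z
    t-m′≢z eq = <⇒≱ (≤-pred k<) (≤-pred (subst (_< suc k) position-z (W-position z∈W)))
      where
      position-z : position z ≡ m′
      position-z = trans (sym (cong position eq)) (position-t ≤-refl)

    prefix-linked : Linked (WalkStep MW′) (t m′ ∷ P)
    prefix-linked = transfer (subst (Linked (WalkStep MW)) (sym ℓ-last) (proj₁ linked-split)) t-m′≢z
      (All.tabulate λ y∈ → (λ eq → proj₂ (proj₂ W-split) y∈ (here refl) eq) , W-corner (P⊆W y∈))

    segment-linked : Linked (WalkStep MW′) (z ∷ Q)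
    segment-linked with _ ∷ l ← proj₂ linked-split | z∉Q ∷ _ ← proj₁ (proj₂ W-split) =
      transfer l (flip-≢ z)
        (All.tabulate λ y∈ → (λ eq → All.lookup z∉Q y∈ (sym eq)) , W-corner (z∷Q⊆W (there y∈)))

    reverse-step : ∀ {x y} → WalkStep MW′ x y → WalkStep MW′ (flip y) (flip x)
    reverse-step {x} {y} step =
      trans (cong MW′ (flip-involutive y)) (trans (cong MW′ (sym step)) (MW′-involutive (flip x)))

    reversed-linked : Linked (WalkStep MW′) (reversed ∷ʳ b⁺)
    reversed-linked = Linked-∷ʳ (revMap flip Q) (flip z) b⁺ (Linked-revMap flip reverse-step segment-linked)
                                (trans (cong MW′ (flip-involutive z)) MW′-z)

    W′-linked : Linked (WalkStep MW′) (t m′ ∷ W′)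
    W′-linked = subst (Linked (WalkStep MW′)) (sym t-m′∷W′≡)
      (Linked-join A ℓ (reversed ∷ʳ b⁺) (subst (Linked (WalkStep MW′)) ℓ-last prefix-linked) from-ℓ)
      where
      t-m′∷W′≡ : t m′ ∷ W′ ≡ A ++ ℓ ∷ reversed ∷ʳ b⁺
      t-m′∷W′≡ = trans (cong (_++ reversed ∷ʳ b⁺) ℓ-last) (++-assoc A [ ℓ ] (reversed ∷ʳ b⁺))
      from-ℓ : Linked (WalkStep MW′) (ℓ ∷ reversed ∷ʳ b⁺)
      from-ℓ with R′ , rev≡ ← reversed-head =
        subst (λ L → Linked (WalkStep MW′) (ℓ ∷ L ∷ʳ b⁺)) (sym rev≡)
          (MW′-p ∷ subst (λ L → Linked (WalkStep MW′) (L ∷ʳ b⁺)) rev≡ reversed-linked)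

    stage : Stage (suc (suc k))
    stage = record
      { W                  = W′
      ; β                  = β′
      ; MW                 = MW′
      ; W-length           = W′-length
      ; W-distinct         = W′-distinct
      ; W-position         = W′-position
      ; W-corner           = W′-corner
      ; W-covers           = W′-covers
      ; W-linked           = W′-linked
      ; W-last             = P ++ reversed , sym (++-assoc P reversed [ b⁺ ])
      ; MW-involutive      = MW′-involutive
      ; vtx-MW             = vtx-MW′
      ; MW-unprocessed     = MW′-unprocessed
      ; β-MW               = β′-MW′
      ; β-MT               = β′-MT
      ; rotation-connected = connected′
      }

  prefix-split : ∀ {f i} → f < i → ∃ λ Q → prefix i ≡ prefix f ++ t f ∷ Q
  prefix-split {f} {suc i} f< with <-suc-cases f<
  ... | inj₂ refl = [] , refl
  ... | inj₁ f<i with Q , eq ← prefix-split f<i =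
    Q ∷ʳ t i , trans (cong (_∷ʳ t i) eq) (++-assoc (prefix f) (t f ∷ Q) [ t i ])

  prefix⁺ : ℕ → List D
  prefix⁺ zero    = []
  prefix⁺ (suc f) = t m′ ∷ prefix f

  t-m′∷prefix : ∀ f → t m′ ∷ prefix f ≡ prefix⁺ f ∷ʳ t (prev f)
  t-m′∷prefix zero    = refl
  t-m′∷prefix (suc f) = refl

  module Revisit {k} (k< : suc k < m) (S : Stage (suc k)) where
    open Stage S

    -- A vertex visited before is on W: at t f itself, or just after flip (t f), which cannot end W.
    on-W : ∀ f → f < suc k → vtx G (t f) ≡ vtx G (t (suc k)) →
           ∃ λ z → z ∈ W × vtx G z ≡ vtx G (t (suc k))
    on-W f f< vf with x , x∈ , ex ← W-covers f f< with same-edge⇒≡⊎flip x (t f) ex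
    ... | inj₁ refl = t f , x∈ , vf
    ... | inj₂ refl with ∈-∃++ x∈
    ...   | P , [] , W≡ = ⊥-elim (flip-≢ (t k) (subst (λ c → flip (t c) ≡ t k) f≡k last))
      where
      last : flip (t f) ≡ t k
      last = proj₂ (∷ʳ-injective P (proj₁ W-last) (trans (sym W≡) (proj₂ W-last)))
      f≡k : f ≡ k
      f≡k = noRepeat f k (<-trans f< k<) (<-trans (n<1+n k) k<) (cong edge last)
    ...   | P , q ∷ Q , W≡ = q , subst (q ∈_) (sym W≡) (∈-++⁺ʳ P (there (here refl))) , (begin
      vtx G q                  ≡⟨ cong (vtx G) step ⟨
      vtx G (MW (flip (flip (t f)))) ≡⟨ vtx-MW _ ⟩
      vtx G (flip (flip (t f)))      ≡⟨ cong (vtx G) (flip-involutive (t f)) ⟩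
      vtx G (t f)              ≡⟨ vf ⟩
      vtx G (t (suc k))        ∎)
      where
      open ≡-Reasoning
      step : MW (flip (flip (t f))) ≡ q
      step with _ , s ∷ _ ← Linked-split (t m′ ∷ P) (flip (t f)) (q ∷ Q)
                               (subst (λ L → Linked (WalkStep MW) (t m′ ∷ L)) W≡ W-linked) = s

    splice : ∀ z → z ∈ W → vtx G z ≡ vtx G (t (suc k)) →
             ∃ λ (S′ : Stage (suc (suc k))) → ∀ c → c < suc k → Stage.β S′ (a c) ≡ β (a c)
    splice z z∈ vz with P , Q , W≡ ← ∈-∃++ z∈ with A , ℓ , ℓ-last ← ∷⇒∃∷ʳ (t m′) P =
      stage , λ c c< → β′-processed (a c) (subst (_< suc k) (sym (corner-a (<-trans c< k<))) c<)
      where open Splice k< S P Q A ℓ z W≡ ℓ-last vz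

  revisit : ∀ {k} → suc k < m → Progress (suc k) → ∀ f → f < suc k → vtx G (t f) ≡ vtx G (t (suc k)) →
            Progress (suc (suc k))
  revisit k< (S , inj₁ twist) f f< vf with z , z∈ , vz ← Revisit.on-W k< S f f< vf
                                      with S′ , same ← Revisit.splice k< S z z∈ vz =
    S′ , inj₁ (Twist-mono S S′ (n≤1+n _) same twist)
  revisit {k} k< (S , inj₂ (W≡ , _)) f f< vf with Q , prefix≡ ← prefix-split f< = S′ , inj₁ twist
    where
    open Splice k< S (prefix f) Q (prefix⁺ f) (t (prev f)) (t f) (trans W≡ prefix≡) (t-m′∷prefix f) vf
      renaming (stage to S′)
    -- The splice at corner f gives a (suc k) the colour opposite to a f.
    twist : Twist S′
    twist = f , suc k , m<n⇒m<1+n f< , ≤-refl , vf , λ eq → not-¬ refl (begin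
      β (a f)       ≡⟨ β′-processed (a f) (subst (_< suc k) (sym (corner-a (<-trans f< k<))) f<) ⟨
      β′ (a f)      ≡⟨ eq ⟩
      β′ a⁺         ≡⟨ β′-a⁺ ⟩
      not (β (a f)) ∎)
      where
      open ≡-Reasoning
      open Stage S using (β)

  step : ∀ {k} → suc k < m → Progress (suc k) → Progress (suc (suc k))
  step {k} k< progress with any? (λ (f : Fin (suc k)) → vtx G (t (toℕ f)) ≟ᶠ vtx G (t (suc k)))
  ... | yes (f , vf) = revisit k< progress (toℕ f) (toℕ<n f) vf
  ... | no none      = extend k< progress λ f f< vf →
    none (fromℕ< f< , subst (λ c → vtx G (t c) ≡ vtx G (t (suc k))) (sym (toℕ-fromℕ< f<)) vf)

  build : ∀ k → suc k ≤ m → Progress (suc k)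
  build zero    _  = Initial.progress
  build (suc k) k< = step k< (build k (≤-trans (n≤1+n _) k<))

  final : Progress m
  final = build m′ ≤-refl

-- The bi-eulerian embedding

module TwoFaceEmbedding {n m′} {G : Graph n (suc m′)} (T : EulerCircuit G) where
  open EulerCircuit T
  open Circuit T
  open Corners T
  open Construction T
  private
    m = suc m′
    D = Dart m

  S : Stage m
  S = proj₁ final
  open Stage S

  ρ ρ⁻ : D → D
  ρ  = rotation β MW
  ρ⁻ = rotation (not ∘ β) MW

  ρ⁻∘ρ : ∀ x → ρ⁻ (ρ x) ≡ x
  ρ⁻∘ρ x = by-colour (β x) refl
    where
    by-colour : ∀ b → β x ≡ b → ρ⁻ (ρ x) ≡ x
    by-colour true  βx = trans (cong ρ⁻ (rotation-true β MW x βx))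
      (trans (rotation-true (not ∘ β) MW (MW x) (cong not (trans (β-MW x) (cong not βx)))) (MW-involutive x))
    by-colour false βx = trans (cong ρ⁻ (rotation-false β MW x βx))
      (trans (rotation-false (not ∘ β) MW (MT x) (cong not (trans (β-MT x) (cong not βx)))) (MT-involutive x))

  ρ∘ρ⁻ : ∀ x → ρ (ρ⁻ x) ≡ x
  ρ∘ρ⁻ x = by-colour (β x) refl
    where
    by-colour : ∀ b → β x ≡ b → ρ (ρ⁻ x) ≡ x
    by-colour true  βx = trans (cong ρ (rotation-false (not ∘ β) MW x (cong not βx)))
      (trans (rotation-false β MW (MT x) (trans (β-MT x) (cong not βx))) (MT-involutive x))
    by-colour false βx = trans (cong ρ (rotation-true (not ∘ β) MW x (cong not βx)))
      (trans (rotation-true β MW (MW x) (trans (β-MW x) (cong not βx))) (MW-involutive x))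

  vtx-ρ : ∀ x → vtx G (ρ x) ≡ vtx G x
  vtx-ρ x = by-colour (β x) refl
    where
    by-colour : ∀ b → β x ≡ b → vtx G (ρ x) ≡ vtx G x
    by-colour true  βx = trans (cong (vtx G) (rotation-true β MW x βx)) (vtx-MW x)
    by-colour false βx = trans (cong (vtx G) (rotation-false β MW x βx)) (vtx-MT x)

  -- Twisting exactly the edges whose two darts have equal colour makes every face follow MT or MW.
  E : Embedding G
  E = record
    { ρ      = ρ
    ; ρ⁻     = ρ⁻
    ; ρ⁻ρ    = ρ⁻∘ρ
    ; ρρ⁻    = ρ∘ρ⁻
    ; ρ-vtx  = vtx-ρ
    ; ρ-cyc  = λ d d′ → rotation-connected d d′ (corner< d) (corner< d′)
    ; sig    = λ e → not (β (e , false) xor β (e , true))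
    }

  open FaceTracing E
  open Embedding E using (sig)

  rot-β : ∀ y → rot (β y) y ≡ MT y
  rot-β y = by-colour (β y) refl
    where
    by-colour : ∀ b → β y ≡ b → rot b y ≡ MT y
    by-colour true  βy = rotation-false (not ∘ β) MW y (cong not βy)
    by-colour false βy = rotation-false β MW y βy

  rot-not-β : ∀ y → rot (not (β y)) y ≡ MW y
  rot-not-β y = by-colour (β y) refl
    where
    by-colour : ∀ b → β y ≡ b → rot (not b) y ≡ MW y
    by-colour true  βy = rotation-true β MW y βy
    by-colour false βy = rotation-true (not ∘ β) MW y (cong not βy)

  sig-T : ∀ d → not (β d) xor sig (edge d) ≡ β (flip d)
  sig-T (e , false) = lemma (β (e , false)) (β (e , true))
    where
    lemma : ∀ x y → not x xor not (x xor y) ≡ y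
    lemma false false = refl
    lemma false true  = refl
    lemma true  false = refl
    lemma true  true  = refl
  sig-T (e , true)  = lemma (β (e , false)) (β (e , true))
    where
    lemma : ∀ x y → not y xor not (x xor y) ≡ x
    lemma false false = refl
    lemma false true  = refl
    lemma true  false = refl
    lemma true  true  = refl

  sig-W : ∀ d → β d xor sig (edge d) ≡ not (β (flip d))
  sig-W d = begin
    β d xor sig (edge d)             ≡⟨ cong (_xor sig (edge d)) (not-involutive (β d)) ⟨
    not (not (β d)) xor sig (edge d) ≡⟨ not-distribˡ-xor (not (β d)) (sig (edge d)) ⟨
    not (not (β d) xor sig (edge d)) ≡⟨ cong not (sig-T d) ⟩
    not (β (flip d))                 ∎
    where open ≡-Reasoning

  T-state : D → State E
  T-state d = (d , not (β d))

  φ-T : ∀ i → φ E (T-state (t i)) ≡ T-state (t (suc i))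
  φ-T i = trans (φ-≡ (t i) (not (β (t i)))) (cong₂ _,_
    (trans (cong (λ b → rot b (flip (t i))) (sig-T (t i))) (trans (rot-β (flip (t i))) (MT-flip-t i)))
    (trans (sig-T (t i)) (begin
      β (flip (t i))             ≡⟨ not-involutive _ ⟨
      not (not (β (flip (t i)))) ≡⟨ cong not (β-MT (flip (t i))) ⟨
      not (β (MT (flip (t i))))  ≡⟨ cong (not ∘ β) (MT-flip-t i) ⟩
      not (β (t (suc i)))        ∎)))
    where open ≡-Reasoning

  iter-φ-T : ∀ i → iter (φ E) i (T-state (t 0)) ≡ T-state (t i)
  iter-φ-T zero    = refl
  iter-φ-T (suc i) = trans (cong (φ E) (iter-φ-T i)) (φ-T i)

  T-face : FaceAt E (T-state (t 0)) t
  T-face = trans (iter-φ-T m) (cong T-state (periodic 0)) , λ i → cong proj₁ (iter-φ-T i)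

  w : ℕ → D
  w j = nth (t 0) W (j % m)

  suc-%≡ : ∀ j → suc j % m ≡ suc (j % m) % m
  suc-%≡ j = trans (cong (λ x → suc x % m) (m≡m%n+[m/n]*n j m)) ([m+kn]%n≡m%n (suc (j % m)) (j / m) m)

  suc-% : ∀ j → (suc (j % m) < m × suc j % m ≡ suc (j % m)) ⊎ (j % m ≡ m′ × suc j % m ≡ 0)
  suc-% j with m≤n⇒m<n∨m≡n (m%n<n j m)
  ... | inj₁ lt = inj₁ (lt , trans (suc-%≡ j) (m<n⇒m%n≡m lt))
  ... | inj₂ eq = inj₂ (suc-injective eq , trans (suc-%≡ j) (trans (cong (_% m) eq) (n%n≡0 m)))

  nth-W-last : nth (t 0) W m′ ≡ t m′
  nth-W-last with W″ , W≡ ← W-last = begin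
    nth (t 0) W m′                 ≡⟨ cong (λ L → nth (t 0) L m′) W≡ ⟩
    nth (t 0) (W″ ∷ʳ t m′) m′      ≡⟨ cong (nth (t 0) (W″ ∷ʳ t m′)) length-W″ ⟨
    nth (t 0) (W″ ∷ʳ t m′) (length W″) ≡⟨ nth-∷ʳ (t 0) W″ (t m′) ⟩
    t m′                           ∎
    where
    open ≡-Reasoning
    length-W″ : length W″ ≡ m′
    length-W″ =
      suc-injective (trans (+-comm 1 _) (trans (sym (length-++ W″)) (trans (cong length (sym W≡)) W-length)))

  W-step : ∀ j → MW (flip (w j)) ≡ w (suc j)
  W-step j with suc-% j
  ... | inj₁ (r+1<m , eq) = subst (λ i → MW (flip (w j)) ≡ nth (t 0) W i) (sym eq)
                              (nth-Linked (t 0) W-linked {suc (j % m)}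
                                (subst (suc (suc (suc (j % m))) ≤_) (cong suc (sym W-length)) (s≤s r+1<m)))
  ... | inj₂ (last , eq)  = subst₂ (λ x i → MW (flip x) ≡ nth (t 0) W i)
                              (trans (sym nth-W-last) (cong (nth (t 0) W) (sym last))) (sym eq)
                              (nth-Linked (t 0) W-linked {0}
                                (subst (2 ≤_) (cong suc (sym W-length)) (s≤s (s≤s z≤n))))

  W-circuit : EulerCircuit G
  W-circuit = closedWalk⇒EulerCircuit w (λ j → cong (nth (t 0) W) ([m+n]%n≡m%n j m))
    (λ j → trans (sym (vtx-MW (flip (w j)))) (cong (vtx G) (W-step j)))
    λ i j i< j< eq → nth-injective (t 0) edge W-distinct
                       (subst (i <_) (sym W-length) i<) (subst (j <_) (sym W-length) j<)
      (subst₂ (λ a b → edge (nth (t 0) W a) ≡ edge (nth (t 0) W b)) (m<n⇒m%n≡m i<) (m<n⇒m%n≡m j<) eq)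

  W-state : D → State E
  W-state d = (d , β d)

  φ-W : ∀ j → φ E (W-state (w j)) ≡ W-state (w (suc j))
  φ-W j = trans (φ-≡ (w j) (β (w j))) (cong₂ _,_
    (trans (cong (λ b → rot b (flip (w j))) (sig-W (w j))) (trans (rot-not-β (flip (w j))) (W-step j)))
    (trans (sig-W (w j)) (trans (sym (β-MW (flip (w j)))) (cong β (W-step j)))))

  iter-φ-W : ∀ j → iter (φ E) j (W-state (w 0)) ≡ W-state (w j)
  iter-φ-W zero    = refl
  iter-φ-W (suc j) = trans (cong (φ E) (iter-φ-W j)) (φ-W j)

  W-face : FaceAt E (W-state (w 0)) w
  W-face = trans (iter-φ-W m) (cong W-state (EulerCircuit.periodic W-circuit 0)) , λ j → cong proj₁ (iter-φ-W j)

  T₀ W₀ : State E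
  T₀ = T-state (t 0)
  W₀ = W-state (w 0)

  faces : List (State E)
  faces = T₀ ∷ rev T₀ ∷ W₀ ∷ rev W₀ ∷ []

  W-covers-t : ∀ i → Orbit W₀ (t i , β (t i)) ⊎ Orbit (rev W₀) (t i , β (t i))
  W-covers-t i with j , _ , ej ← EulerCircuit.allEdges W-circuit (edge (t i))
               with same-edge⇒≡⊎flip (w j) (t i) ej
  ... | inj₁ wj≡ = inj₁ (j , trans (iter-φ-W j) (cong W-state wj≡))
  ... | inj₂ wj≡ = inj₂ (subst (Orbit (rev W₀)) rev≡ (Orbit-sym (j , iter-rev j W₀)))
    where
    flip-wj : flip (w j) ≡ t i
    flip-wj = trans (cong flip wj≡) (flip-involutive (t i))
    rev≡ : rev (iter (φ E) j W₀) ≡ (t i , β (t i))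
    rev≡ = trans (cong rev (iter-φ-W j)) (cong₂ _,_ flip-wj
             (trans (cong not (sig-W (w j))) (trans (not-involutive _) (cong β flip-wj))))

  ≢not⇒≡ : ∀ {s b} → s ≢ not b → s ≡ b
  ≢not⇒≡ {false} {false} _  = refl
  ≢not⇒≡ {true}  {true}  _  = refl
  ≢not⇒≡ {false} {true}  s≢ = ⊥-elim (s≢ refl)
  ≢not⇒≡ {true}  {false} s≢ = ⊥-elim (s≢ refl)

  -- A state on t i has either the colour of the T-face or that of the W-face.
  cover-t : ∀ i s → ∃ λ z → z ∈ faces × Orbit z (t i , s)
  cover-t i s with s ≟ᵇ not (β (t i))
  ... | yes refl = T₀ , here refl , i , iter-φ-T i
  ... | no s≢ with refl ← ≢not⇒≡ s≢ with W-covers-t i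
  ...   | inj₁ o = W₀ , there (there (here refl)) , o
  ...   | inj₂ o = rev W₀ , there (there (there (here refl))) , o

  rev-faces : ∀ {z y} → z ∈ faces → Orbit (rev z) y → ∃ λ z′ → z′ ∈ faces × Orbit z′ y
  rev-faces (here refl)                         o = rev T₀ , there (here refl) , o
  rev-faces (there (here refl))                 o = T₀ , here refl , subst (λ u → Orbit u _) (rev-involutive T₀) o
  rev-faces (there (there (here refl)))         o = rev W₀ , there (there (there (here refl))) , o
  rev-faces (there (there (there (here refl)))) o =
    W₀ , there (there (here refl)) , subst (λ u → Orbit u _) (rev-involutive W₀) o

  cover : ∀ x → ∃ λ z → z ∈ faces × Orbit z x
  cover (d , s) with same-edge⇒≡⊎flip d (t (position d)) (sym (edge-t-position d))
  ... | inj₁ d≡ with z , z∈ , o ← cover-t (position d) s =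
    z , z∈ , subst (λ y → Orbit z (y , s)) (sym d≡) o
  ... | inj₂ d≡ with z , z∈ , o ← cover-t (position d) (proj₂ (rev (d , s))) =
    rev-faces z∈ (Orbit-sym (subst (λ u → Orbit u (rev z)) (rev-involutive (d , s))
                                   (Orbit-rev (subst (Orbit z) (sym rev≡) o))))
    where
    rev≡ : rev (d , s) ≡ (t (position d) , proj₂ (rev (d , s)))
    rev≡ = cong (_, proj₂ (rev (d , s))) (trans (cong flip d≡) (flip-involutive _))

  has-face-T : HasFaceT E T
  has-face-T = T₀ , T-face

  numFaces≡2 : numFaces E ≡ 2
  numFaces≡2 = cong (_/ 2) (≤-antisym (numOrbits-≤ faces cover) (4≤numOrbits E has-face-T))

  circuit-at : ∀ {z} → z ∈ faces → ∀ k →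
               ∃ λ (C : EulerCircuit G) → FaceAt E (iter (φ E) k z) (EulerCircuit.t C)
  circuit-at (here refl)                         k = shift k , FaceAt-shift E T-face k
  circuit-at (there (here refl))                 k = reverse (k * m′) ,
    subst (λ y → FaceAt E y (λ i → flip (t (k * m′ + i * m′)))) (sym (iter-from-rev E (proj₁ T-face) 0 k))
          (FaceAt-rev E T-face (k * m′))
  circuit-at (there (there (here refl)))         k = Circuit.shift W-circuit k , FaceAt-shift E W-face k
  circuit-at (there (there (there (here refl)))) k = Circuit.reverse W-circuit (k * m′) ,
    subst (λ y → FaceAt E y (λ i → flip (w (k * m′ + i * m′)))) (sym (iter-from-rev E (proj₁ W-face) 0 k))
          (FaceAt-rev E W-face (k * m′))

  bi-eulerian : BiEulerian E
  bi-eulerian = numFaces≡2 , λ x → case cover x of λ where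
    (z , z∈ , k , refl) → circuit-at z∈ k

  -- Under a switching σ, the T-face state bit at corner c, xor σ there, would be constant along T;
  -- but that bit is β (a c), which a twist makes differ at two corners of one vertex.
  twist⇒nonorientable : Twist S → ¬ Orientable E
  twist⇒nonorientable (c , c′ , c< , c′< , vcc′ , differ) (σ , σ-sig) =
    differ (trans (β-a c<) (trans same-ε (sym (β-a c′<))))
    where
    xor-xor : ∀ x z → (x xor z) xor z ≡ x
    xor-xor x z = trans (xor-assoc x z z) (trans (cong (x xor_) (xor-same z)) (xor-identityʳ x))
    ε : ℕ → Bool
    ε i = not (β (t i))
    β-a : ∀ {c} → c < m → β (a c) ≡ ε c
    β-a {c} c< = trans (sym (not-involutive _)) (cong not (trans (sym (β-MT (a c))) (cong β (MT-a c<))))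
    ε-step : ∀ i → ε (suc i) ≡ ε i xor sig (edge (t i))
    ε-step i = trans (cong proj₂ (sym (φ-T i))) (cong proj₂ (φ-≡ (t i) (ε i)))
    σ-ends : ∀ d → σ (Graph.end G (edge d) false) xor σ (Graph.end G (edge d) true) ≡
                   σ (vtx G d) xor σ (hd G d)
    σ-ends (e , false) = refl
    σ-ends (e , true)  = xor-comm (σ (Graph.end G e false)) (σ (Graph.end G e true))
    sig-t : ∀ i → sig (edge (t i)) ≡ σ (vtx G (t i)) xor σ (vtx G (t (suc i)))
    sig-t i = trans (σ-sig (edge (t i)))
                    (trans (σ-ends (t i)) (cong (λ u → σ (vtx G (t i)) xor σ u) (consecutive i)))
    invariant : ∀ i → ε i xor σ (vtx G (t i)) ≡ ε 0 xor σ (vtx G (t 0))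
    invariant zero    = refl
    invariant (suc i) = trans (cong (_xor σ (vtx G (t (suc i)))) (trans (ε-step i) (cong (ε i xor_) (sig-t i))))
                              (trans (xor-assoc (ε i) _ _) (trans (cong (ε i xor_) (xor-xor _ _)) (invariant i)))
    same-ε : ε c ≡ ε c′
    same-ε = trans (sym (xor-xor (ε c) _)) (trans (cong (_xor σ (vtx G (t c′))) eq) (xor-xor (ε c′) _))
      where
      eq : ε c xor σ (vtx G (t c′)) ≡ ε c′ xor σ (vtx G (t c′))
      eq = trans (cong (λ u → ε c xor σ u) (sym vcc′)) (trans (invariant c) (sym (invariant c′)))

  nonorientable-unless-cycle : ¬ IsCycle G → ¬ Orientable E
  nonorientable-unless-cycle ¬cycle with proj₂ final
  ... | inj₁ twist        = twist⇒nonorientable twist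
  ... | inj₂ (_ , fresh)  = ⊥-elim (¬cycle (fresh⇒cycle fresh))

-- Euler genus

module _ {n m} {G : Graph n m} where

  eulerGenus-2-faces : (E : Embedding G) → numFaces E ≡ 2 → eulerGenus E ≡ + m - + n
  eulerGenus-2-faces E two = begin
    + (2 + m) - + (n + numFaces E) ≡⟨ cong (λ f → + (2 + m) - + (n + f)) two ⟩
    + (2 + m) - + (n + 2)          ≡⟨ ℤ.[+m]-[+n]≡m⊖n (2 + m) (n + 2) ⟩
    (2 + m) ⊖ (n + 2)              ≡⟨ cong ((2 + m) ⊖_) (+-comm n 2) ⟩
    (2 + m) ⊖ (2 + n)              ≡⟨ ℤ.[1+m]⊖[1+n]≡m⊖n (suc m) (suc n) ⟩
    suc m ⊖ suc n                  ≡⟨ ℤ.[1+m]⊖[1+n]≡m⊖n m n ⟩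
    m ⊖ n                          ≡⟨ ℤ.[+m]-[+n]≡m⊖n m n ⟨
    + m - + n                      ∎
    where open ≡-Reasoning

  eulerGenus-antitone : (E E′ : Embedding G) → numFaces E ≤ numFaces E′ → eulerGenus E′ ≤ℤ eulerGenus E
  eulerGenus-antitone E E′ ≤f = ℤ.+-monoʳ-≤ (+ (2 + m)) (ℤ.neg-mono-≤ (+≤+ (+-monoʳ-≤ n ≤f)))

  genus-monotone : (E E′ : Embedding G) → eulerGenus E′ ≤ℤ eulerGenus E → (Orientable E ⇔ Orientable E′) →
                   ∀ {g g′} → HasGenus E g → HasGenus E′ g′ → g′ ≤ g
  genus-monotone E E′ ≤eg iff (inj₁ (_ , eg)) (inj₁ (_ , eg′)) =
    *-cancelˡ-≤ 2 (ℤ.drop‿+≤+ (subst₂ _≤ℤ_ eg′ eg ≤eg))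
  genus-monotone E E′ ≤eg iff (inj₂ (_ , eg)) (inj₂ (_ , eg′)) = ℤ.drop‿+≤+ (subst₂ _≤ℤ_ eg′ eg ≤eg)
  genus-monotone E E′ ≤eg iff (inj₁ (o , _))  (inj₂ (¬o′ , _)) = ⊥-elim (¬o′ (Equivalence.to iff o))
  genus-monotone E E′ ≤eg iff (inj₂ (¬o , _)) (inj₁ (o′ , _))  = ⊥-elim (¬o (Equivalence.from iff o′))

2≤numFaces : ∀ {n m′} {G : Graph n (suc m′)} (T : EulerCircuit G) (E : Embedding G) → HasFaceT E T →
             2 ≤ numFaces E
2≤numFaces T E face = /-monoˡ-≤ 2 (Circuit.4≤numOrbits T E face)

2-faces⇒maximal : ∀ {n m′} {G : Graph n (suc m′)} (T : EulerCircuit G) (E : Embedding G) → numFaces E ≡ 2 →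
                  ∀ E′ → HasFaceT E′ T → eulerGenus E′ ≤ℤ eulerGenus E
2-faces⇒maximal T E two E′ face′ =
  eulerGenus-antitone E E′ (subst (_≤ numFaces E′) (sym two) (2≤numFaces T E′ face′))

corollary6p6 : ∀ {n m} (G : Graph n m) → 1 ≤ m → (T : EulerCircuit G) →
    (∃ λ (E : Embedding G) → BiEulerian E × HasFaceT E T)
    × (¬ IsCycle G → ∃ λ (E : Embedding G) → BiEulerian E × HasFaceT E T × ¬ Orientable E)
    × (∀ (E : Embedding G) → BiEulerian E → HasFaceT E T →
         (eulerGenus E ≡ (+ m) - (+ n))
         × (∀ (E' : Embedding G) → HasFaceT E' T → eulerGenus E' ≤ℤ eulerGenus E)
         × (∀ (E' : Embedding G) → HasFaceT E' T → (Orientable E ⇔ Orientable E') →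
              ∀ g g' → HasGenus E g → HasGenus E' g' → g' ≤ g))
corollary6p6 {m = suc _} G (s≤s z≤n) T =
    (E , bi-eulerian , has-face-T)
  , (λ ¬cycle → E , bi-eulerian , has-face-T , nonorientable-unless-cycle ¬cycle)
  , λ B (two , _) _ →
      eulerGenus-2-faces B two ,
      2-faces⇒maximal T B two ,
      λ E′ face′ iff _ _ → genus-monotone B E′ (2-faces⇒maximal T B two E′ face′) iff
  where open TwoFaceEmbedding T
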